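{- Let $(P,\mathcal T)$ be a hybrid program, $G$ a goal with constraint $C_0$ and rule literals $\bar L$, $M_0$ a model of $\mathcal T$, and $k$ a countable ordinal. Assume that $M_0$ is a Herbrand interpretation, or that the set of constraints has the witness property, or that $P$ is safe. (1) If $C$ is an answer of a t-tree of rank $k$ for $G$, then for every substitution $\theta$ replacing the free variables of $G$ by ground terms, $M_0\models C\theta$ implies $\Psi_{P/M_0}\!\uparrow\!(k+1)\models_3 G\theta$. (2) If $C$ is a negative answer of a tu-tree of rank $k$ for $G$, then for every substitution $\theta$ replacing the free variables of $G$ by ground terms, $M_0\models C\theta$ implies $\Psi_{P/M_0}\!\uparrow\!(k+1)\models_3\neg G\theta$.
   Context: Hybrid programs. Predicate symbols are split into disjoint sets of rule predicates and constraint predicates; $\mathcal F$ is a set of function symbols (with at least one constant). An external theory $\mathcal T$ is a set of first-order axioms over the constraint predicates and $\mathcal F$; a distinguished set of formulas over these are the constraints. Rule literals are atoms with a rule predicate or their (non-monotonic) negations. A hybrid rule is $H\leftarrow C,L_1,\dots,L_n$ with $H$ a rule atom, $L_i$ rule literals, $C$ a constraint; a hybrid program is $(P,\mathcal T)$ with $P$ a set of hybrid rules. A goal is $C,L_1,\dots,L_n$ with $C$ a constraint (the constraint of the goal) and $L_i$ rule literals. Let $\mathcal H$ be the set of ground rule atoms. A 3-valued interpretation is $I\subseteq\mathcal H\cup\{\neg A:A\in\mathcal H\}$ not containing both $A$ and $\neg A$; literals in $I$ are true, those whose complement is in $I$ are false, others undefined, extended to formulas by Kleene logic; $I\models_3F$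 means $F$ is true in $I$. For a ground normal program $Q$ (treat $\neg p$ as new predicates so $Q$ is definite; $\mathcal M_R$ is the least Herbrand model of a definite program $R$): $Q/_tI=Q\cup\{\neg A:\neg A\in I\}$, $Q/_{tu}I=Q\cup\{\neg A:A\in\mathcal H,A\notin I\}$, $\Psi_Q(I)=(\mathcal M_{Q/_tI}\cap\mathcal H)\cup\{\neg A:A\in\mathcal H\setminus\mathcal M_{Q/_{tu}I}\}$. Iterates: $\Psi_Q\!\uparrow\!0=\emptyset$, $\Psi_Q\!\uparrow\!(\alpha+1)=\Psi_Q(\Psi_Q\!\uparrow\!\alpha)$, and unions at limit ordinals. For a model $M_0$ of $\mathcal T$, $P/M_0$ is obtained from the ground instances $H\theta\leftarrow C\theta,\bar L\theta$ of rules of $P$ by deleting rules with $M_0\not\models C\theta$ and deleting the constraint from the others. For a goal $G=C_0,\bar L$ and a grounding substitution $\theta$ for its free variables, $I\models_3G\theta$ means $M_0\models C_0\theta$ and $I\models_3\bar L\theta$, and $I\models_3\neg G\theta$ means $M_0\not\models C_0\theta$ or $I\models_3\neg(\bar L\theta)$ (the constraint is evaluated in $M_0$, and $G\theta$ stands for $\bar L\theta$ when $M_0\models C_0\theta$). Standing assumptions for the operational semantics: $=$ is a constraint predicate, $\mathcal T$ contains Clark's equality theory, constraints include term equalities and are closed under $\wedge,\vee,\neg,\exists$. A constraint is satisfiable if true in some model of $\mathcal T$ under some assignment. Operational semantics. $\exists_{ -V}F$ is $\exists x_1\dots x_nF$ for $x_i$ the free variables of $F$ not in $V$; $\exists_{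 -F'}F=\exists_{ -V}F$ with $V$ the free variables of $F'$. For a goal $G'=C,\bar L,p(\bar t),\bar L'$ and a variable-disjoint rule $p(\bar u)\leftarrow C',\bar K$, the goal $\bar t=\bar u,C,C',\bar L,\bar K,\bar L'$ is derived from $G'$ if $\bar t=\bar u\wedge C\wedge C'$ is satisfiable. A t-tree (tu-tree) of rank $k$ (countable ordinal) for goal $G$ w.r.t. $(P,\mathcal T)$: a tree of goals with root $G$, with a rule literal selected in each node having one; nodes without rule literals are successful. (i) Selected atom: children are the goals derived by variants (fresh w.r.t. the path from the root) of rules of $P$, one per rule for which a derived goal exists. (ii) Selected $\neg A$ in $G'=C,\bar L,\neg A,\bar L'$: in a t-tree, $G'$ is a leaf or has the single child $C',C,\bar L,\bar L'$ where $C'$ is a negative answer of a tu-tree of rank $<k$ for $C,A$ and $C'\wedge C$ is satisfiable; in a tu-tree, $G'$ has the single child $C,\bar L,\bar L'$, or the single child $\neg C'',C,\bar L,\bar L'$ where $C''$ is an answer of a t-tree of rank $<k$ for $C,A$ and $\neg C''\wedge C$ is satisfiable, or $G'$ is a leaf and there is an answer $C''$ of a t-tree of rank $<k$ for $C,A$ with $\neg C''\wedge C$ unsatisfiable. An answer of a t-tree for $G$ is $\exists_{ -G}(C_1\vee\dots\vee C_n)$ ($n\ge0$) for constraints $C_i$ of some successful leaves. A cross-section of a tu-tree is a set of nodes meeting every branch ending in a successful leaf; if the constraints of its nodes are finitely many, $C_1,\dots,C_n$, then $\bigwedge_i\neg(\exists_{ -G}C_i)$ is a negative answer; if infinitely many,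 any constraint with free variables among those of $G$ implying every $\neg(\exists_{ -G}C_i)$ is a negative answer. Safeness: $x$ is bound in $C$ to ground term $t$ (variable $y$) if $\mathcal T\models C\to x=t$ ($\mathcal T\models C\to x=y$). A rule $H\leftarrow C,\bar L$ is safe if each variable of $H$, of each negative literal of $\bar L$, and each free variable of $C$ is bound in $C$ to a ground term or to a variable occurring in a positive literal of $\bar L$; $P$ is safe if all its rules are. Witness property: for every model $M$ of $\mathcal T$ and constraint $C$, $M\models\exists C$ implies $M\models C\theta$ for some substitution $\theta$ grounding the free variables of $C$. -}

module Defs where

open import Level using (Level; 0ℓ) renaming (suc to lsuc)
open import Data.Nat using (ℕ; _≟_)
open import Data.Bool using (if_then_else_)
open import Data.Empty using (⊥)
open import Data.Unit using (⊤)
open import Data.Product using (Σ; _×_; _,_; proj₁; proj₂)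
open import Data.Sum using (_⊎_)
open import Data.Vec using (Vec; []; _∷_; lookup) renaming (map to vmap; toList to vtoList)
open import Data.Fin using (Fin)
open import Data.List using (List; []; _∷_; _++_; map; filter; deduplicate; foldr; concatMap)
open import Data.List.Relation.Unary.All using (All)
open import Data.List.Relation.Unary.Any using (Any)
open import Data.List.Relation.Unary.Unique.Propositional using (Unique)
open import Data.List.Membership.Propositional using (_∈_; _∉_)
open import Data.List.Membership.DecPropositional _≟_ using (_∈?_)
open import Relation.Nullary using (¬_; does; ¬?)
open import Relation.Binary.PropositionalEquality using (_≡_; _≢_; subst; sym)
open import Function using (_∘_; _↔_)
open import Function.Definitions using (Injective)

-- Countable ordinals, as Brouwer ordinal notations (trees).
-- olim f denotes the supremum of the f n.

data Ord : Set where
  oz   : Ord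
  os   : Ord → Ord
  olim : (ℕ → Ord) → Ord

data _≤o_ : Ord → Ord → Set where
  ≤o-zero     : ∀ {a} → oz ≤o a
  ≤o-refl     : ∀ {a} → a ≤o a
  ≤o-trans    : ∀ {a b c} → a ≤o b → b ≤o c → a ≤o c
  ≤o-suc      : ∀ {a b} → a ≤o b → os a ≤o os b
  ≤o-cocone   : ∀ {a f} (n : ℕ) → a ≤o f n → a ≤o olim f
  ≤o-limiting : ∀ {f b} → (∀ n → f n ≤o b) → olim f ≤o b

_<o_ : Ord → Ord → Set
a <o b = os a ≤o b

-- Signatures: function symbols (with a constant), rule predicates,
-- constraint predicates (equality is built in as a constraint predicate).

record Sig : Set₁ where
  field
    Fun       : Set
    arity     : Fun → ℕ
    RPred     : Set
    rarity    : RPred → ℕ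
    CPred     : Set
    carity    : CPred → ℕ
    cst       : Fun
    cst-const : arity cst ≡ 0

module Hybrid (S : Sig) where
  open Sig S public

  Var : Set
  Var = ℕ

  data Term : Set where
    var : Var → Term
    fn  : (f : Fun) → Vec Term (arity f) → Term

  data GTerm : Set where
    gfn : (f : Fun) → Vec GTerm (arity f) → GTerm

  embed  : GTerm → Term
  embedV : ∀ {n} → Vec GTerm n → Vec Term n
  embed (gfn f ts) = fn f (embedV ts)
  embedV [] = []
  embedV (t ∷ ts) = embed t ∷ embedV ts

  infix 7 _≐_
  data Form : Set where
    cat   : (p : CPred) → Vec Term (carity p) → Form
    _≐_   : Term → Term → Form
    ¬f_   : Form → Form
    _∧f_  : Form → Form → Form
    _∨f_  : Form → Form → Form
    _⇒f_  : Form → Form → Form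
    ∃f    : Var → Form → Form
    ∀f    : Var → Form → Form

  cstT : Term
  cstT = fn cst (subst (Vec Term) (sym cst-const) [])

  ⊤f : Form
  ⊤f = cstT ≐ cstT

  ⊥f : Form
  ⊥f = ¬f ⊤f

  disj : List Form → Form
  disj [] = ⊥f
  disj (c ∷ []) = c
  disj (c ∷ cs@(_ ∷ _)) = c ∨f disj cs

  conj : List Form → Form
  conj [] = ⊤f
  conj (c ∷ []) = c
  conj (c ∷ cs@(_ ∷ _)) = c ∧f conj cs

  eqsF : ∀ {n} → Vec Term n → Vec Term n → Form → Form
  eqsF [] [] C = C
  eqsF (t ∷ ts) (u ∷ us) C = (t ≐ u) ∧f eqsF ts us C

  fvT : Term → List Var
  fvV : ∀ {n} → Vec Term n → List Var
  fvT (var x) = x ∷ []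
  fvT (fn f ts) = fvV ts
  fvV [] = []
  fvV (t ∷ ts) = fvT t ++ fvV ts

  fvF : Form → List Var
  fvF (cat p ts) = fvV ts
  fvF (t ≐ u) = fvT t ++ fvT u
  fvF (¬f F) = fvF F
  fvF (F ∧f G) = fvF F ++ fvF G
  fvF (F ∨f G) = fvF F ++ fvF G
  fvF (F ⇒f G) = fvF F ++ fvF G
  fvF (∃f x F) = filter (λ y → ¬? (y ≟ x)) (fvF F)
  fvF (∀f x F) = filter (λ y → ¬? (y ≟ x)) (fvF F)

  renT : (ℕ → ℕ) → Term → Term
  renV : (ℕ → ℕ) → ∀ {n} → Vec Term n → Vec Term n
  renT σ (var x) = var (σ x)
  renT σ (fn f ts) = fn f (renV σ ts)
  renV σ [] = []
  renV σ (t ∷ ts) = renT σ t ∷ renV σ ts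

  renF : (ℕ → ℕ) → Form → Form
  renF σ (cat p ts) = cat p (renV σ ts)
  renF σ (t ≐ u) = renT σ t ≐ renT σ u
  renF σ (¬f F) = ¬f renF σ F
  renF σ (F ∧f G) = renF σ F ∧f renF σ G
  renF σ (F ∨f G) = renF σ F ∨f renF σ G
  renF σ (F ⇒f G) = renF σ F ⇒f renF σ G
  renF σ (∃f x F) = ∃f (σ x) (renF σ F)
  renF σ (∀f x F) = ∀f (σ x) (renF σ F)

  -- substitution of free variables (only used with ground terms, so no capture)
  subT : (Var → Term) → Term → Term
  subV : (Var → Term) → ∀ {n} → Vec Term n → Vec Term n
  subT σ (var x) = σ x
  subT σ (fn f ts) = fn f (subV σ ts)
  subV σ [] = []
  subV σ (t ∷ ts) = subT σ t ∷ subV σ ts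

  keep : Var → (Var → Term) → (Var → Term)
  keep x σ y = if does (y ≟ x) then var x else σ y

  subF : (Var → Term) → Form → Form
  subF σ (cat p ts) = cat p (subV σ ts)
  subF σ (t ≐ u) = subT σ t ≐ subT σ u
  subF σ (¬f F) = ¬f subF σ F
  subF σ (F ∧f G) = subF σ F ∧f subF σ G
  subF σ (F ∨f G) = subF σ F ∨f subF σ G
  subF σ (F ⇒f G) = subF σ F ⇒f subF σ G
  subF σ (∃f x F) = ∃f x (subF (keep x σ) F)
  subF σ (∀f x F) = ∀f x (subF (keep x σ) F)

  _[_]F : Form → (Var → GTerm) → Form
  C [ θ ]F = subF (embed ∘ θ) C

  exClose : List Var → Form → Form
  exClose xs F = foldr ∃f F xs

  RAtom : Set
  RAtom = Σ RPred (λ p → Vec Term (rarity p))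

  data Lit : Set where
    pos : RAtom → Lit
    neg : RAtom → Lit

  record Rule : Set where
    constructor rule
    field
      head : RAtom
      con  : Form
      body : List Lit

  record Goal : Set where
    constructor goal
    field
      gcon : Form
      lits : List Lit

  open Rule public
  open Goal public

  fvA : RAtom → List Var
  fvA (p , ts) = fvV ts

  fvL : Lit → List Var
  fvL (pos A) = fvA A
  fvL (neg A) = fvA A

  fvLits : List Lit → List Var
  fvLits = concatMap fvL

  fvPosLits : List Lit → List Var
  fvPosLits [] = []
  fvPosLits (pos A ∷ Ls) = fvA A ++ fvPosLits Ls
  fvPosLits (neg A ∷ Ls) = fvPosLits Ls

  fvNegLits : List Lit → List Var
  fvNegLits [] = []
  fvNegLits (pos A ∷ Ls) = fvNegLits Ls
  fvNegLits (neg A ∷ Ls) = fvA A ++ fvNegLits Ls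

  fvGoal : Goal → List Var
  fvGoal G = fvF (gcon G) ++ fvLits (lits G)

  fvRule : Rule → List Var
  fvRule r = fvA (head r) ++ fvF (con r) ++ fvLits (body r)

  ∃₋ : Goal → Form → Form
  ∃₋ G F = exClose (filter (λ x → ¬? (x ∈? fvGoal G)) (deduplicate _≟_ (fvF F))) F

  renA : (ℕ → ℕ) → RAtom → RAtom
  renA σ (p , ts) = p , renV σ ts

  renL : (ℕ → ℕ) → Lit → Lit
  renL σ (pos A) = pos (renA σ A)
  renL σ (neg A) = neg (renA σ A)

  renRule : (ℕ → ℕ) → Rule → Rule
  renRule σ r = rule (renA σ (head r)) (renF σ (con r)) (map (renL σ) (body r))

  GAtom : Set
  GAtom = Σ RPred (λ p → Vec GTerm (rarity p))

  data GLit : Set where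
    gpos : GAtom → GLit
    gneg : GAtom → GLit

  compl : GLit → GLit
  compl (gpos A) = gneg A
  compl (gneg A) = gpos A

  record GRule : Set where
    constructor grule
    field
      ghead : GAtom
      gbody : List GLit

  gT : (Var → GTerm) → Term → GTerm
  gV : (Var → GTerm) → ∀ {n} → Vec Term n → Vec GTerm n
  gT θ (var x) = θ x
  gT θ (fn f ts) = gfn f (gV θ ts)
  gV θ [] = []
  gV θ (t ∷ ts) = gT θ t ∷ gV θ ts

  gA : (Var → GTerm) → RAtom → GAtom
  gA θ (p , ts) = p , gV θ ts

  gL : (Var → GTerm) → Lit → GLit
  gL θ (pos A) = gpos (gA θ A)
  gL θ (neg A) = gneg (gA θ A)

  groundRule : (Var → GTerm) → Rule → GRule
  groundRule θ r = grule (gA θ (head r)) (map (gL θ) (body r))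

  -- Semantics of the external theory (classical first-order logic with
  -- built-in equality; classicality is supplied by excluded middle in the theorem)

  record Structure : Set₁ where
    field
      Carrier : Set
      fun     : (f : Fun) → Vec Carrier (arity f) → Carrier
      rel     : (p : CPred) → Vec Carrier (carity p) → Set

  module _ (M : Structure) where
    open Structure M

    evT : (Var → Carrier) → Term → Carrier
    evV : (Var → Carrier) → ∀ {n} → Vec Term n → Vec Carrier n
    evT ρ (var x) = ρ x
    evT ρ (fn f ts) = fun f (evV ρ ts)
    evV ρ [] = []
    evV ρ (t ∷ ts) = evT ρ t ∷ evV ρ ts

    upd : (Var → Carrier) → Var → Carrier → (Var → Carrier)
    upd ρ x d y = if does (y ≟ x) then d else ρ y

    ⟦_⟧ : Form → (Var → Carrier) → Set
    ⟦ cat p ts ⟧ ρ = rel p (evV ρ ts)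
    ⟦ t ≐ u ⟧ ρ = evT ρ t ≡ evT ρ u
    ⟦ ¬f F ⟧ ρ = ¬ ⟦ F ⟧ ρ
    ⟦ F ∧f G ⟧ ρ = ⟦ F ⟧ ρ × ⟦ G ⟧ ρ
    ⟦ F ∨f G ⟧ ρ = ⟦ F ⟧ ρ ⊎ ⟦ G ⟧ ρ
    ⟦ F ⇒f G ⟧ ρ = ⟦ F ⟧ ρ → ⟦ G ⟧ ρ
    ⟦ ∃f x F ⟧ ρ = Σ Carrier (λ d → ⟦ F ⟧ (upd ρ x d))
    ⟦ ∀f x F ⟧ ρ = (d : Carrier) → ⟦ F ⟧ (upd ρ x d)

  _⊨_ : Structure → Form → Set
  M ⊨ F = ∀ ρ → ⟦_⟧ M F ρ

  Theory : Set₁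
  Theory = Form → Set

  Model : Theory → Structure → Set
  Model T M = ∀ F → T F → M ⊨ F

  _⊨T_ : Theory → Form → Set₁
  T ⊨T F = (M : Structure) → Model T M → M ⊨ F

  Satisfiable : Theory → Form → Set₁
  Satisfiable T F = Σ Structure (λ M → Model T M × Σ (Var → Structure.Carrier M) (λ ρ → ⟦_⟧ M F ρ))

  -- Clark's equality theory (the equality axioms proper are built in)
  conjEqs : ∀ {n} → Vec Var n → Vec Var n → Form
  conjEqs xs ys = conj (vtoList (eqs xs ys))
    where
      eqs : ∀ {n} → Vec Var n → Vec Var n → Vec Form n
      eqs [] [] = []
      eqs (x ∷ xs) (y ∷ ys) = (var x ≐ var y) ∷ eqs xs ys

  data CET : Form → Set where
    cet-inj   : (f : Fun) (xs ys : Vec Var (arity f)) → Unique (vtoList xs ++ vtoList ys) →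
                CET ((fn f (vmap var xs) ≐ fn f (vmap var ys)) ⇒f conjEqs xs ys)
    cet-clash : (f g : Fun) (xs : Vec Var (arity f)) (ys : Vec Var (arity g)) →
                Unique (vtoList xs ++ vtoList ys) → f ≢ g →
                CET (¬f (fn f (vmap var xs) ≐ fn g (vmap var ys)))
    cet-occ   : (t : Term) (x : Var) → x ∈ fvT t → t ≢ var x → CET (¬f (t ≐ var x))

  record StandingAssumptions (T : Theory) (IsC : Form → Set) : Set where
    field
      cet-⊆ : ∀ F → CET F → T F
      eqC   : ∀ t u → IsC (t ≐ u)
      ∧C    : ∀ F G → IsC F → IsC G → IsC (F ∧f G)
      ∨C    : ∀ F G → IsC F → IsC G → IsC (F ∨f G)
      ¬C    : ∀ F → IsC F → IsC (¬f F)
      ∃C    : ∀ x F → IsC F → IsC (∃f x F)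

  Herbrand : Structure → Set
  Herbrand M = Σ (Structure.Carrier M ↔ GTerm) (λ h →
    ∀ (f : Fun) (ds : Vec (Structure.Carrier M) (arity f)) →
      Function.Bundles.Inverse.to h (Structure.fun M f ds) ≡ gfn f (vmap (Function.Bundles.Inverse.to h) ds))
    where import Function.Bundles

  WitnessProperty : Theory → (Form → Set) → Set₁
  WitnessProperty T IsC = (M : Structure) → Model T M → (C : Form) → IsC C →
    M ⊨ exClose (deduplicate _≟_ (fvF C)) C → Σ (Var → GTerm) (λ θ → M ⊨ (C [ θ ]F))

  BoundTo : Theory → Form → Var → Term → Set₁
  BoundTo T C x t = T ⊨T (C ⇒f (var x ≐ t))

  SafeRule : Theory → Rule → Set₁
  SafeRule T r = ∀ x → (x ∈ fvA (head r) ⊎ x ∈ fvNegLits (body r) ⊎ x ∈ fvF (con r)) →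
    Σ GTerm (λ t → BoundTo T (con r) x (embed t))
    ⊎ Σ Var (λ y → y ∈ fvPosLits (body r) × BoundTo T (con r) x (var y))

  SafeProgram : Theory → (Rule → Set) → Set₁
  SafeProgram T P = ∀ r → P r → SafeRule T r

  Interp : Set₁
  Interp = GLit → Set

  litH : (GAtom → Set) → (GAtom → Set) → GLit → Set
  litH Pos Neg (gpos A) = Pos A
  litH Pos Neg (gneg A) = Neg A

  -- least Herbrand model of the definite program Q ∪ {¬A : Neg A}
  -- (restricted to the positive atoms of H)
  data LM (Q : GRule → Set) (Neg : GAtom → Set) : GAtom → Set where
    derive : ∀ {h bd} → Q (grule h bd) → All (litH (LM Q Neg) Neg) bd → LM Q Neg h

  Ψ : (GRule → Set) → Interp → Interp
  Ψ Q I (gpos A) = LM Q (λ B → I (gneg B)) A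
  Ψ Q I (gneg A) = ¬ LM Q (λ B → ¬ I (gpos B)) A

  Ψ↑ : (GRule → Set) → Ord → Interp
  Ψ↑ Q oz = λ _ → ⊥
  Ψ↑ Q (os a) = Ψ Q (Ψ↑ Q a)
  Ψ↑ Q (olim f) = λ l → Σ ℕ (λ n → Ψ↑ Q (f n) l)

  _/M_ : (Rule → Set) → Structure → GRule → Set
  (P /M M0) gr = Σ Rule (λ r → P r × Σ (Var → GTerm) (λ θ →
                   M0 ⊨ (con r [ θ ]F) × gr ≡ groundRule θ r))

  Holds3 : Structure → Interp → Goal → (Var → GTerm) → Set
  Holds3 M0 I G θ = M0 ⊨ (gcon G [ θ ]F) × All (λ L → I (gL θ L)) (lits G)

  HoldsNeg3 : Structure → Interp → Goal → (Var → GTerm) → Set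
  HoldsNeg3 M0 I G θ = (¬ M0 ⊨ (gcon G [ θ ]F)) ⊎ Any (λ L → I (compl (gL θ L))) (lits G)

  record Tree : Set₁ where
    coinductive
    field
      label : Goal
      Child : Set
      child : Child → Tree
  open Tree public

  data Node : Tree → Set₁ where
    here  : ∀ {t} → Node t
    there : ∀ {t} (c : Child t) → Node (child t c) → Node t

  subAt : ∀ {t} → Node t → Tree
  subAt {t} here = t
  subAt (there c n) = subAt n

  labelAt : ∀ {t} → Node t → Goal
  labelAt n = label (subAt n)

  pathGoals : ∀ {t} → Node t → List Goal
  pathGoals {t} here = label t ∷ []
  pathGoals {t} (there c n) = label t ∷ pathGoals n

  data _≼_ : ∀ {t} → Node t → Node t → Set₁ where
    here≼  : ∀ {t} {n : Node t} → _≼_ {t} here n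
    there≼ : ∀ {t} {c : Child t} {m n : Node (child t c)} → _≼_ {child t c} m n → _≼_ {t} (there c m) (there c n)

  Successful : Goal → Set
  Successful G = lits G ≡ []

  Answer : Tree → Form → Set₁
  Answer t C = Σ (List (Node t)) (λ ns → All (λ n → Successful (labelAt n)) ns ×
                 C ≡ ∃₋ (label t) (disj (map (gcon ∘ labelAt) ns)))

  CrossSection : (t : Tree) → (Node t → Set) → Set₁
  CrossSection t Sn = ∀ (n : Node t) → Successful (labelAt n) → Σ (Node t) (λ m → m ≼ n × Sn m)

  Enumerates : (t : Tree) → (Node t → Set) → List Form → Set₁
  Enumerates t Sn cs = ∀ F → (F ∈ cs → Σ (Node t) (λ n → Sn n × gcon (labelAt n) ≡ F))
                           × (Σ (Node t) (λ n → Sn n × gcon (labelAt n) ≡ F) → F ∈ cs)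

  module Trees (T : Theory) (IsC : Form → Set) (P : Rule → Set) where

    NegAnswer : Tree → Form → Set₁
    NegAnswer t C = Σ (Node t → Set) (λ Sn → CrossSection t Sn ×
      ( Σ (List Form) (λ cs → Enumerates t Sn cs × C ≡ conj (map (λ Ci → ¬f ∃₋ (label t) Ci) cs))
      ⊎ ((¬ Σ (List Form) (Enumerates t Sn)) × IsC C
          × (∀ x → x ∈ fvF C → x ∈ fvGoal (label t))
          × (∀ n → Sn n → T ⊨T (C ⇒f (¬f ∃₋ (label t) (gcon (labelAt n))))))))

    Variant : Rule → Rule → Set
    Variant r r' = Σ (ℕ → ℕ) (λ σ → Injective _≡_ _≡_ σ × r' ≡ renRule σ r)

    Fresh : Rule → List Goal → Set
    Fresh r' gs = ∀ x → x ∈ fvRule r' → All (λ g → x ∉ fvGoal g) gs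

    data Derives (Ls Ls' : List Lit) (C : Form) : RAtom → Rule → Goal → Set where
      der : ∀ {p ts us C' K} →
            Derives Ls Ls' C (p , ts) (rule (p , us) C' K) (goal (eqsF ts us (C ∧f C')) (Ls ++ K ++ Ls'))

    Expands : List Goal → List Lit → List Lit → Form → RAtom → Rule → Goal → Set₁
    Expands gs Ls Ls' C A r G'' = Σ Rule (λ r' → Variant r r' × Fresh r' gs ×
                                    Derives Ls Ls' C A r' G'' × Satisfiable T (gcon G''))

    -- selected atom A: one child per applicable rule of P
    PosStep : List Goal → List Lit → List Lit → Form → RAtom → Tree → Set₁
    PosStep gs Ls Ls' C A s = Σ (Child s → Rule) (λ ro →
        (∀ c → P (ro c))
      × (∀ c c' → ro c ≡ ro c' → c ≡ c')
      × (∀ c → Expands gs Ls Ls' C A (ro c) (label (child s c)))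
      × (∀ r → P r → Σ Goal (Expands gs Ls Ls' C A r) → Σ (Child s) (λ c → ro c ≡ r)))

    Single : Tree → Set
    Single s = Σ (Child s) (λ c → ∀ c' → c' ≡ c)

    theChild : (s : Tree) → Single s → Tree
    theChild s (c , _) = child s c

    -- NA G C: C is a negative answer of a tu-tree of smaller rank for G
    TSel : (Goal → Form → Set₁) → List Goal → List Lit → Lit → List Lit → Form → Tree → Set₁
    TSel NA gs Ls (pos A) Ls' C s = PosStep gs Ls Ls' C A s
    TSel NA gs Ls (neg A) Ls' C s =
      (¬ Child s)
      ⊎ Σ (Single s) (λ sg → Σ Form (λ C' → NA (goal C (pos A ∷ [])) C'
            × Satisfiable T (C' ∧f C) × label (theChild s sg) ≡ goal (C' ∧f C) (Ls ++ Ls')))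

    -- AN G C: C is an answer of a t-tree of smaller rank for G
    TUSel : (Goal → Form → Set₁) → List Goal → List Lit → Lit → List Lit → Form → Tree → Set₁
    TUSel AN gs Ls (pos A) Ls' C s = PosStep gs Ls Ls' C A s
    TUSel AN gs Ls (neg A) Ls' C s =
      Σ (Single s) (λ sg → label (theChild s sg) ≡ goal C (Ls ++ Ls'))
      ⊎ Σ (Single s) (λ sg → Σ Form (λ C'' → AN (goal C (pos A ∷ [])) C''
            × Satisfiable T ((¬f C'') ∧f C) × label (theChild s sg) ≡ goal ((¬f C'') ∧f C) (Ls ++ Ls')))
      ⊎ ((¬ Child s) × Σ Form (λ C'' → AN (goal C (pos A ∷ [])) C'' × ¬ Satisfiable T ((¬f C'') ∧f C)))

    NodeCond : (List Goal → List Lit → Lit → List Lit → Form → Tree → Set₁) → Tree → List Goal → Set₁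
    NodeCond Sel s gs =
      (Successful (label s) × ¬ Child s)
      ⊎ Σ (List Lit) (λ Ls → Σ Lit (λ L → Σ (List Lit) (λ Ls' →
          (lits (label s) ≡ Ls ++ L ∷ Ls') × Sel gs Ls L Ls' (gcon (label s)) s)))

    data TTree (k : Ord) (t : Tree) : Set₁
    data TUTree (k : Ord) (t : Tree) : Set₁

    data TTree k t where
      ttree : (∀ (n : Node t) → NodeCond
                 (TSel (λ G C → Σ Ord (λ j → j <o k × Σ Tree (λ t' → TUTree j t' × label t' ≡ G × NegAnswer t' C))))
                 (subAt n) (pathGoals n))
              → TTree k t

    data TUTree k t where
      tutree : (∀ (n : Node t) → NodeCond
                 (TUSel (λ G C → Σ Ord (λ j → j <o k × Σ Tree (λ t' → TTree j t' × label t' ≡ G × Answer t' C))))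
                 (subAt n) (pathGoals n))
              → TUTree k t

module Submission where

-- Both parts are proved together by induction on the rank k: a negative literal in a tree of rank k is
-- handled through an answer or negative answer of a tree of smaller rank, hence by the induction hypothesis
-- at an earlier stage of Ψ.
--
-- Answers: a successful leaf whose constraint holds under a ground valuation agreeing with θ makes, going up
-- its branch, every goal on the branch true in Ψ↑(k+1), since a resolution step is undone by a ground instance
-- of the rule, which belongs to P/M0.  Such a valuation is where the three alternative hypotheses enter: in a
-- Herbrand model every valuation is ground; with the witness property the (equivalently rewritten) leaf
-- constraint has a ground solution; for a safe program every variable value at a leaf is generated from
-- ground terms, since safeness ties each new variable to a positive literal and a successful leaf has none.
--
-- Negative answers: if Gθ were not false in Ψ↑(k+1) then, classically, each of its atoms has a derivation in
-- the least model defining Ψ.  Resolving along these derivations descends the tu-tree with decreasing total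
-- derivation size to a successful leaf whose constraint is satisfiable together with C, contradicting the
-- cross-section refuted by C.

open import Defs
open import Level using (0ℓ; Lift; lift; lower) renaming (suc to lsuc)
open import Axiom.ExcludedMiddle using (ExcludedMiddle)
open import Data.Nat using (ℕ; zero; suc; _+_; _∸_; _⊔_; _≤_; _<_; s≤s; _≟_)
open import Data.Nat.Properties
  using (+-suc; +-identityʳ; +-assoc; +-cancelˡ-≡; ≤-refl; ≤-trans; ≤-<-trans; <-irrefl; <⇒≢; n≤1+n; n<1+n;
         m≤m+n; m≤m⊔n; m≤n⊔m; m+n∸m≡n; +-monoʳ-<)
open import Data.Bool using (if_then_else_)
open import Data.Empty using (⊥; ⊥-elim)
open import Data.Unit using (⊤; tt)
open import Data.Fin using (Fin; toℕ) renaming (zero to fz; suc to fs)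
open import Data.Product using (Σ; _×_; _,_; proj₁; proj₂)
open import Data.Product.Properties using (Σ-≡,≡←≡)
open import Data.Sum using (_⊎_; inj₁; inj₂; [_,_]′)
open import Data.Vec using (Vec; []; _∷_; lookup; tabulate) renaming (map to vmap; toList to vtoList)
open import Data.Vec.Properties using (tabulate∘lookup; tabulate-cong; lookup∘tabulate; lookup-map; ∷-injective)
open import Data.List using (List; []; _∷_; _++_; map; filter; deduplicate)
open import Data.List.Properties using (++-assoc)
open import Data.List.Relation.Unary.All as All using (All; []; _∷_)
import Data.List.Relation.Unary.All.Properties as All
open import Data.List.Relation.Unary.Any as Any using (Any; here; there)
import Data.List.Relation.Unary.Any.Properties as Any
open import Data.List.Relation.Unary.AllPairs using (AllPairs; []; _∷_)
open import Data.List.Membership.Propositional using (_∈_; _∉_; find; lose)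
open import Data.List.Membership.Propositional.Properties
  using (∈-++⁺ˡ; ∈-++⁺ʳ; ∈-++⁻; ∈-map⁺; ∈-map⁻; ∈-filter⁺; ∈-filter⁻; ∈-deduplicate⁺)
open import Data.List.Membership.DecPropositional _≟_ using (_∈?_)
open import Relation.Nullary using (¬_; Dec; yes; no; does; ¬?)
open import Relation.Binary.PropositionalEquality using (_≡_; _≢_; refl; sym; trans; cong; cong₂; subst)
open import Function using (_∘_; id)
open import Function.Bundles using (Inverse; Equivalence; _⇔_; mk⇔)
open import Function.Definitions using (Injective)

if-yes : ∀ {A P : Set} (p : Dec P) (a b : A) → P → (if does p then a else b) ≡ a
if-yes (yes _) a b _ = refl
if-yes (no ¬p) a b p = ⊥-elim (¬p p)

if-no : ∀ {A P : Set} (p : Dec P) (a b : A) → ¬ P → (if does p then a else b) ≡ b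
if-no (yes p) a b ¬p = ⊥-elim (¬p p)
if-no (no _) a b _ = refl

module FormulaSemantics (S : Sig) where
  open Hybrid S

  keep-≡ : ∀ x σ → keep x σ x ≡ var x
  keep-≡ x σ = if-yes (x ≟ x) (var x) (σ x) refl

  keep-≢ : ∀ x σ y → y ≢ x → keep x σ y ≡ σ y
  keep-≢ x σ y y≢x = if-no (y ≟ x) (var x) (σ y) y≢x

  module _ (M : Structure) where
    open Structure M

    Env : Set
    Env = Var → Carrier

    upd-≡ : ∀ (ρ : Env) x d → upd M ρ x d x ≡ d
    upd-≡ ρ x d = if-yes (x ≟ x) d (ρ x) refl

    upd-≢ : ∀ (ρ : Env) x d y → y ≢ x → upd M ρ x d y ≡ ρ y
    upd-≢ ρ x d y y≢x = if-no (y ≟ x) d (ρ y) y≢x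

    Agree : Env → Env → List Var → Set
    Agree ρ ρ' xs = ∀ x → x ∈ xs → ρ x ≡ ρ' x

    agree-sym : ∀ {ρ ρ' xs} → Agree ρ ρ' xs → Agree ρ' ρ xs
    agree-sym a x m = sym (a x m)

    agree-++ˡ : ∀ {ρ ρ'} xs {ys} → Agree ρ ρ' (xs ++ ys) → Agree ρ ρ' xs
    agree-++ˡ xs a x m = a x (∈-++⁺ˡ m)

    agree-++ʳ : ∀ {ρ ρ'} xs {ys} → Agree ρ ρ' (xs ++ ys) → Agree ρ ρ' ys
    agree-++ʳ xs a x m = a x (∈-++⁺ʳ xs m)

    evT-agree : ∀ ρ ρ' t → Agree ρ ρ' (fvT t) → evT M ρ t ≡ evT M ρ' t
    evV-agree : ∀ ρ ρ' {n} (ts : Vec Term n) → Agree ρ ρ' (fvV ts) → evV M ρ ts ≡ evV M ρ' ts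
    evT-agree ρ ρ' (var x) a = a x (here refl)
    evT-agree ρ ρ' (fn f ts) a = cong (fun f) (evV-agree ρ ρ' ts a)
    evV-agree ρ ρ' [] a = refl
    evV-agree ρ ρ' (t ∷ ts) a =
      cong₂ _∷_ (evT-agree ρ ρ' t (agree-++ˡ (fvT t) a)) (evV-agree ρ ρ' ts (agree-++ʳ (fvT t) a))

    agree-upd : ∀ ρ ρ' x d F → Agree ρ ρ' (filter (λ y → ¬? (y ≟ x)) (fvF F)) →
                Agree (upd M ρ x d) (upd M ρ' x d) (fvF F)
    agree-upd ρ ρ' x d F a y m with y ≟ x
    ... | yes refl = trans (upd-≡ ρ y d) (sym (upd-≡ ρ' y d))
    ... | no y≢x = trans (upd-≢ ρ x d y y≢x)
                     (trans (a y (∈-filter⁺ (λ y → ¬? (y ≟ x)) m y≢x)) (sym (upd-≢ ρ' x d y y≢x)))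

    ⟦⟧-agree : ∀ F ρ ρ' → Agree ρ ρ' (fvF F) → ⟦_⟧ M F ρ → ⟦_⟧ M F ρ'
    ⟦⟧-agree (cat p ts) ρ ρ' a h = subst (rel p) (evV-agree ρ ρ' ts a) h
    ⟦⟧-agree (t ≐ u) ρ ρ' a h =
      trans (sym (evT-agree ρ ρ' t (agree-++ˡ (fvT t) a))) (trans h (evT-agree ρ ρ' u (agree-++ʳ (fvT t) a)))
    ⟦⟧-agree (¬f F) ρ ρ' a h = λ h' → h (⟦⟧-agree F ρ' ρ (agree-sym a) h')
    ⟦⟧-agree (F ∧f G) ρ ρ' a (h₁ , h₂) =
      ⟦⟧-agree F ρ ρ' (agree-++ˡ (fvF F) a) h₁ , ⟦⟧-agree G ρ ρ' (agree-++ʳ (fvF F) a) h₂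
    ⟦⟧-agree (F ∨f G) ρ ρ' a (inj₁ h) = inj₁ (⟦⟧-agree F ρ ρ' (agree-++ˡ (fvF F) a) h)
    ⟦⟧-agree (F ∨f G) ρ ρ' a (inj₂ h) = inj₂ (⟦⟧-agree G ρ ρ' (agree-++ʳ (fvF F) a) h)
    ⟦⟧-agree (F ⇒f G) ρ ρ' a h = λ h' →
      ⟦⟧-agree G ρ ρ' (agree-++ʳ (fvF F) a) (h (⟦⟧-agree F ρ' ρ (agree-sym (agree-++ˡ (fvF F) a)) h'))
    ⟦⟧-agree (∃f x F) ρ ρ' a (d , h) = d , ⟦⟧-agree F (upd M ρ x d) (upd M ρ' x d) (agree-upd ρ ρ' x d F a) h
    ⟦⟧-agree (∀f x F) ρ ρ' a h = λ d → ⟦⟧-agree F (upd M ρ x d) (upd M ρ' x d) (agree-upd ρ ρ' x d F a) (h d)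

    ⟦⟧-≗ : ∀ F ρ ρ' → (∀ x → ρ x ≡ ρ' x) → ⟦_⟧ M F ρ → ⟦_⟧ M F ρ'
    ⟦⟧-≗ F ρ ρ' e = ⟦⟧-agree F ρ ρ' (λ x _ → e x)

    evT-subT : ∀ σ ρ t → evT M ρ (subT σ t) ≡ evT M (λ y → evT M ρ (σ y)) t
    evV-subV : ∀ σ ρ {n} (ts : Vec Term n) → evV M ρ (subV σ ts) ≡ evV M (λ y → evT M ρ (σ y)) ts
    evT-subT σ ρ (var x) = refl
    evT-subT σ ρ (fn f ts) = cong (fun f) (evV-subV σ ρ ts)
    evV-subV σ ρ [] = refl
    evV-subV σ ρ (t ∷ ts) = cong₂ _∷_ (evT-subT σ ρ t) (evV-subV σ ρ ts)

    -- Each variable is kept or replaced by a closed term, so subF cannot capture.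
    CaptureFree : (Var → Term) → Set
    CaptureFree σ = ∀ y → (σ y ≡ var y) ⊎ (∀ z → z ∉ fvT (σ y))

    captureFree-keep : ∀ σ x → CaptureFree σ → CaptureFree (keep x σ)
    captureFree-keep σ x cf y with y ≟ x
    ... | yes refl = inj₁ (keep-≡ y σ)
    ... | no y≢x with cf y
    ...   | inj₁ e = inj₁ (trans (keep-≢ x σ y y≢x) e)
    ...   | inj₂ c = inj₂ (subst (λ t → ∀ z → z ∉ fvT t) (sym (keep-≢ x σ y y≢x)) c)

    evT-keep : ∀ σ x → CaptureFree σ → ∀ ρ d y →
               evT M (upd M ρ x d) (keep x σ y) ≡ upd M (λ z → evT M ρ (σ z)) x d y
    evT-keep σ x cf ρ d y with y ≟ x
    ... | yes refl = trans (cong (evT M (upd M ρ y d)) (keep-≡ y σ))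
                       (trans (upd-≡ ρ y d) (sym (upd-≡ (λ z → evT M ρ (σ z)) y d)))
    ... | no y≢x = trans (cong (evT M (upd M ρ x d)) (keep-≢ x σ y y≢x))
                     (trans (unaffected (cf y)) (sym (upd-≢ (λ z → evT M ρ (σ z)) x d y y≢x)))
      where
        unaffected : _ → evT M (upd M ρ x d) (σ y) ≡ evT M ρ (σ y)
        unaffected (inj₁ e) rewrite e = upd-≢ ρ x d y y≢x
        unaffected (inj₂ c) = evT-agree (upd M ρ x d) ρ (σ y) (λ z m → ⊥-elim (c z m))

    ⟦⟧-subF : ∀ σ → CaptureFree σ → ∀ F ρ →
              (⟦_⟧ M (subF σ F) ρ → ⟦_⟧ M F (λ y → evT M ρ (σ y)))
            × (⟦_⟧ M F (λ y → evT M ρ (σ y)) → ⟦_⟧ M (subF σ F) ρ)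
    ⟦⟧-subF σ cf (cat p ts) ρ = subst (rel p) (evV-subV σ ρ ts) , subst (rel p) (sym (evV-subV σ ρ ts))
    ⟦⟧-subF σ cf (t ≐ u) ρ =
      (λ h → trans (sym (evT-subT σ ρ t)) (trans h (evT-subT σ ρ u))) ,
      (λ h → trans (evT-subT σ ρ t) (trans h (sym (evT-subT σ ρ u))))
    ⟦⟧-subF σ cf (¬f F) ρ =
      (λ h h' → h (proj₂ (⟦⟧-subF σ cf F ρ) h')) , (λ h h' → h (proj₁ (⟦⟧-subF σ cf F ρ) h'))
    ⟦⟧-subF σ cf (F ∧f G) ρ =
      (λ { (a , b) → proj₁ (⟦⟧-subF σ cf F ρ) a , proj₁ (⟦⟧-subF σ cf G ρ) b }) ,
      (λ { (a , b) → proj₂ (⟦⟧-subF σ cf F ρ) a , proj₂ (⟦⟧-subF σ cf G ρ) b })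
    ⟦⟧-subF σ cf (F ∨f G) ρ =
      (λ { (inj₁ a) → inj₁ (proj₁ (⟦⟧-subF σ cf F ρ) a) ; (inj₂ b) → inj₂ (proj₁ (⟦⟧-subF σ cf G ρ) b) }) ,
      (λ { (inj₁ a) → inj₁ (proj₂ (⟦⟧-subF σ cf F ρ) a) ; (inj₂ b) → inj₂ (proj₂ (⟦⟧-subF σ cf G ρ) b) })
    ⟦⟧-subF σ cf (F ⇒f G) ρ =
      (λ h a → proj₁ (⟦⟧-subF σ cf G ρ) (h (proj₂ (⟦⟧-subF σ cf F ρ) a))) ,
      (λ h a → proj₂ (⟦⟧-subF σ cf G ρ) (h (proj₁ (⟦⟧-subF σ cf F ρ) a)))
    ⟦⟧-subF σ cf (∃f x F) ρ =
      (λ { (d , h) → d , ⟦⟧-≗ F _ _ (evT-keep σ x cf ρ d) (proj₁ (under d) h) }) ,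
      (λ { (d , h) → d , proj₂ (under d) (⟦⟧-≗ F _ _ (λ y → sym (evT-keep σ x cf ρ d y)) h) })
      where under = λ d → ⟦⟧-subF (keep x σ) (captureFree-keep σ x cf) F (upd M ρ x d)
    ⟦⟧-subF σ cf (∀f x F) ρ =
      (λ h d → ⟦⟧-≗ F _ _ (evT-keep σ x cf ρ d) (proj₁ (under d) (h d))) ,
      (λ h d → proj₂ (under d) (⟦⟧-≗ F _ _ (λ y → sym (evT-keep σ x cf ρ d y)) (h d)))
      where under = λ d → ⟦⟧-subF (keep x σ) (captureFree-keep σ x cf) F (upd M ρ x d)

    evT-renT : ∀ σ ρ t → evT M ρ (renT σ t) ≡ evT M (ρ ∘ σ) t
    evV-renV : ∀ σ ρ {n} (ts : Vec Term n) → evV M ρ (renV σ ts) ≡ evV M (ρ ∘ σ) ts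
    evT-renT σ ρ (var x) = refl
    evT-renT σ ρ (fn f ts) = cong (fun f) (evV-renV σ ρ ts)
    evV-renV σ ρ [] = refl
    evV-renV σ ρ (t ∷ ts) = cong₂ _∷_ (evT-renT σ ρ t) (evV-renV σ ρ ts)

    upd-∘-injective : ∀ σ → Injective _≡_ _≡_ σ → ∀ ρ x d y → upd M ρ (σ x) d (σ y) ≡ upd M (ρ ∘ σ) x d y
    upd-∘-injective σ inj ρ x d y with y ≟ x
    ... | yes refl = trans (upd-≡ ρ (σ y) d) (sym (upd-≡ (ρ ∘ σ) y d))
    ... | no y≢x = trans (upd-≢ ρ (σ x) d (σ y) (λ e → y≢x (inj e))) (sym (upd-≢ (ρ ∘ σ) x d y y≢x))

    ⟦⟧-renF : ∀ σ → Injective _≡_ _≡_ σ → ∀ F ρ →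
              (⟦_⟧ M (renF σ F) ρ → ⟦_⟧ M F (ρ ∘ σ)) × (⟦_⟧ M F (ρ ∘ σ) → ⟦_⟧ M (renF σ F) ρ)
    ⟦⟧-renF σ i (cat p ts) ρ = subst (rel p) (evV-renV σ ρ ts) , subst (rel p) (sym (evV-renV σ ρ ts))
    ⟦⟧-renF σ i (t ≐ u) ρ =
      (λ h → trans (sym (evT-renT σ ρ t)) (trans h (evT-renT σ ρ u))) ,
      (λ h → trans (evT-renT σ ρ t) (trans h (sym (evT-renT σ ρ u))))
    ⟦⟧-renF σ i (¬f F) ρ = (λ h h' → h (proj₂ (⟦⟧-renF σ i F ρ) h')) , (λ h h' → h (proj₁ (⟦⟧-renF σ i F ρ) h'))
    ⟦⟧-renF σ i (F ∧f G) ρ =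
      (λ { (a , b) → proj₁ (⟦⟧-renF σ i F ρ) a , proj₁ (⟦⟧-renF σ i G ρ) b }) ,
      (λ { (a , b) → proj₂ (⟦⟧-renF σ i F ρ) a , proj₂ (⟦⟧-renF σ i G ρ) b })
    ⟦⟧-renF σ i (F ∨f G) ρ =
      (λ { (inj₁ a) → inj₁ (proj₁ (⟦⟧-renF σ i F ρ) a) ; (inj₂ b) → inj₂ (proj₁ (⟦⟧-renF σ i G ρ) b) }) ,
      (λ { (inj₁ a) → inj₁ (proj₂ (⟦⟧-renF σ i F ρ) a) ; (inj₂ b) → inj₂ (proj₂ (⟦⟧-renF σ i G ρ) b) })
    ⟦⟧-renF σ i (F ⇒f G) ρ =
      (λ h a → proj₁ (⟦⟧-renF σ i G ρ) (h (proj₂ (⟦⟧-renF σ i F ρ) a))) ,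
      (λ h a → proj₂ (⟦⟧-renF σ i G ρ) (h (proj₁ (⟦⟧-renF σ i F ρ) a)))
    ⟦⟧-renF σ i (∃f x F) ρ =
      (λ { (d , h) → d , ⟦⟧-≗ F _ _ (upd-∘-injective σ i ρ x d) (proj₁ (under d) h) }) ,
      (λ { (d , h) → d , proj₂ (under d) (⟦⟧-≗ F _ _ (λ y → sym (upd-∘-injective σ i ρ x d y)) h) })
      where under = λ d → ⟦⟧-renF σ i F (upd M ρ (σ x) d)
    ⟦⟧-renF σ i (∀f x F) ρ =
      (λ h d → ⟦⟧-≗ F _ _ (upd-∘-injective σ i ρ x d) (proj₁ (under d) (h d))) ,
      (λ h d → proj₂ (under d) (⟦⟧-≗ F _ _ (λ y → sym (upd-∘-injective σ i ρ x d y)) (h d)))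
      where under = λ d → ⟦⟧-renF σ i F (upd M ρ (σ x) d)

    exClose-intro : ∀ xs F ρ ρ' → (∀ y → y ∉ xs → y ∈ fvF F → ρ' y ≡ ρ y) → ⟦_⟧ M F ρ' →
                    ⟦_⟧ M (exClose xs F) ρ
    exClose-intro [] F ρ ρ' a h = ⟦⟧-agree F ρ' ρ (λ y m → a y (λ ()) m) h
    exClose-intro (x ∷ xs) F ρ ρ' a h = ρ' x , exClose-intro xs F (upd M ρ x (ρ' x)) ρ' a' h
      where
        a' : ∀ y → y ∉ xs → y ∈ fvF F → ρ' y ≡ upd M ρ x (ρ' x) y
        a' y y∉xs m with y ≟ x
        ... | yes refl = sym (upd-≡ ρ y (ρ' y))
        ... | no y≢x = trans (a y (λ { (here e) → y≢x e ; (there p) → y∉xs p }) m) (sym (upd-≢ ρ x (ρ' x) y y≢x))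

    exClose-elim : ∀ xs F ρ → ⟦_⟧ M (exClose xs F) ρ →
                   Σ Env (λ ρ' → ⟦_⟧ M F ρ' × (∀ y → y ∉ xs → ρ' y ≡ ρ y))
    exClose-elim [] F ρ h = ρ , h , λ _ _ → refl
    exClose-elim (x ∷ xs) F ρ (d , h) with exClose-elim xs F (upd M ρ x d) h
    ... | ρ' , h' , a = ρ' , h' , λ y y∉ → trans (a y (λ m → y∉ (there m))) (upd-≢ ρ x d y (λ e → y∉ (here e)))

    ⟦disj⟧⁻ : ∀ cs ρ → ⟦_⟧ M (disj cs) ρ → Any (λ c → ⟦_⟧ M c ρ) cs
    ⟦disj⟧⁻ [] ρ h = ⊥-elim (h refl)
    ⟦disj⟧⁻ (c ∷ []) ρ h = here h
    ⟦disj⟧⁻ (c ∷ cs@(_ ∷ _)) ρ (inj₁ h) = here h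
    ⟦disj⟧⁻ (c ∷ cs@(_ ∷ _)) ρ (inj₂ h) = there (⟦disj⟧⁻ cs ρ h)

    ⟦conj⟧⁻ : ∀ cs ρ → ⟦_⟧ M (conj cs) ρ → All (λ c → ⟦_⟧ M c ρ) cs
    ⟦conj⟧⁻ [] ρ h = []
    ⟦conj⟧⁻ (c ∷ []) ρ h = h ∷ []
    ⟦conj⟧⁻ (c ∷ cs@(_ ∷ _)) ρ (h , h') = h ∷ ⟦conj⟧⁻ cs ρ h'

    ⟦conj⟧⁺ : ∀ cs ρ → All (λ c → ⟦_⟧ M c ρ) cs → ⟦_⟧ M (conj cs) ρ
    ⟦conj⟧⁺ [] ρ h = refl
    ⟦conj⟧⁺ (c ∷ []) ρ (h ∷ []) = h
    ⟦conj⟧⁺ (c ∷ cs@(_ ∷ _)) ρ (h ∷ h') = h , ⟦conj⟧⁺ cs ρ h'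

    ⟦eqsF⟧⁻ : ∀ {n} (ts us : Vec Term n) C ρ → ⟦_⟧ M (eqsF ts us C) ρ →
              (evV M ρ ts ≡ evV M ρ us) × ⟦_⟧ M C ρ
    ⟦eqsF⟧⁻ [] [] C ρ h = refl , h
    ⟦eqsF⟧⁻ (t ∷ ts) (u ∷ us) C ρ (e , h) with ⟦eqsF⟧⁻ ts us C ρ h
    ... | e' , h' = cong₂ _∷_ e e' , h'

    ⟦eqsF⟧⁺ : ∀ {n} (ts us : Vec Term n) C ρ → evV M ρ ts ≡ evV M ρ us → ⟦_⟧ M C ρ →
              ⟦_⟧ M (eqsF ts us C) ρ
    ⟦eqsF⟧⁺ [] [] C ρ e h = h
    ⟦eqsF⟧⁺ (t ∷ ts) (u ∷ us) C ρ e h =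
      proj₁ (∷-injective e) , ⟦eqsF⟧⁺ ts us C ρ (proj₂ (∷-injective e)) h

module FreeVariables (S : Sig) where
  open Hybrid S

  fvL⊆fvLits : ∀ L Ls x → L ∈ Ls → x ∈ fvL L → x ∈ fvLits Ls
  fvL⊆fvLits L (L' ∷ Ls) x (here refl) m = ∈-++⁺ˡ m
  fvL⊆fvLits L (L' ∷ Ls) x (there p) m = ∈-++⁺ʳ (fvL L') (fvL⊆fvLits L Ls x p m)

  fvLits-++⁻ : ∀ xs {ys} x → x ∈ fvLits (xs ++ ys) → x ∈ fvLits xs ⊎ x ∈ fvLits ys
  fvLits-++⁻ [] x m = inj₂ m
  fvLits-++⁻ (L ∷ xs) x m with ∈-++⁻ (fvL L) m
  ... | inj₁ p = inj₁ (∈-++⁺ˡ p)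
  ... | inj₂ p = [ (λ q → inj₁ (∈-++⁺ʳ (fvL L) q)) , inj₂ ]′ (fvLits-++⁻ xs x p)

  fvLits-++ˡ : ∀ xs {ys} x → x ∈ fvLits xs → x ∈ fvLits (xs ++ ys)
  fvLits-++ˡ (L ∷ xs) x m with ∈-++⁻ (fvL L) m
  ... | inj₁ p = ∈-++⁺ˡ p
  ... | inj₂ p = ∈-++⁺ʳ (fvL L) (fvLits-++ˡ xs x p)

  fvLits-++ʳ : ∀ xs {ys} x → x ∈ fvLits ys → x ∈ fvLits (xs ++ ys)
  fvLits-++ʳ [] x m = m
  fvLits-++ʳ (L ∷ xs) x m = ∈-++⁺ʳ (fvL L) (fvLits-++ʳ xs x m)

  fvPosLits-++⁻ : ∀ xs {ys} x → x ∈ fvPosLits (xs ++ ys) → x ∈ fvPosLits xs ⊎ x ∈ fvPosLits ys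
  fvPosLits-++⁻ [] x m = inj₂ m
  fvPosLits-++⁻ (pos A ∷ xs) x m with ∈-++⁻ (fvA A) m
  ... | inj₁ p = inj₁ (∈-++⁺ˡ p)
  ... | inj₂ p = [ (λ q → inj₁ (∈-++⁺ʳ (fvA A) q)) , inj₂ ]′ (fvPosLits-++⁻ xs x p)
  fvPosLits-++⁻ (neg A ∷ xs) x m = fvPosLits-++⁻ xs x m

  fvPosLits-++ˡ : ∀ xs {ys} x → x ∈ fvPosLits xs → x ∈ fvPosLits (xs ++ ys)
  fvPosLits-++ˡ (pos A ∷ xs) x m with ∈-++⁻ (fvA A) m
  ... | inj₁ p = ∈-++⁺ˡ p
  ... | inj₂ p = ∈-++⁺ʳ (fvA A) (fvPosLits-++ˡ xs x p)
  fvPosLits-++ˡ (neg A ∷ xs) x m = fvPosLits-++ˡ xs x m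

  fvPosLits-++ʳ : ∀ xs {ys} x → x ∈ fvPosLits ys → x ∈ fvPosLits (xs ++ ys)
  fvPosLits-++ʳ [] x m = m
  fvPosLits-++ʳ (pos A ∷ xs) x m = ∈-++⁺ʳ (fvA A) (fvPosLits-++ʳ xs x m)
  fvPosLits-++ʳ (neg A ∷ xs) x m = fvPosLits-++ʳ xs x m

  fvLits⊆fvPosLits∪fvNegLits : ∀ Ls x → x ∈ fvLits Ls → x ∈ fvPosLits Ls ⊎ x ∈ fvNegLits Ls
  fvLits⊆fvPosLits∪fvNegLits (pos A ∷ Ls) x m with ∈-++⁻ (fvA A) m
  ... | inj₁ p = inj₁ (∈-++⁺ˡ p)
  ... | inj₂ p = [ (λ q → inj₁ (∈-++⁺ʳ (fvA A) q)) , inj₂ ]′ (fvLits⊆fvPosLits∪fvNegLits Ls x p)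
  fvLits⊆fvPosLits∪fvNegLits (neg A ∷ Ls) x m with ∈-++⁻ (fvA A) m
  ... | inj₁ p = inj₂ (∈-++⁺ˡ p)
  ... | inj₂ p = [ inj₁ , (λ q → inj₂ (∈-++⁺ʳ (fvA A) q)) ]′ (fvLits⊆fvPosLits∪fvNegLits Ls x p)

  fvF-eqsF : ∀ {n} (ts us : Vec Term n) X x → x ∈ fvF (eqsF ts us X) → x ∈ fvV ts ⊎ x ∈ fvV us ⊎ x ∈ fvF X
  fvF-eqsF [] [] X x m = inj₂ (inj₂ m)
  fvF-eqsF (t ∷ ts) (u ∷ us) X x m with ∈-++⁻ (fvT t ++ fvT u) m
  ... | inj₁ p = [ (λ q → inj₁ (∈-++⁺ˡ q)) , (λ q → inj₂ (inj₁ (∈-++⁺ˡ q))) ]′ (∈-++⁻ (fvT t) p)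
  ... | inj₂ p with fvF-eqsF ts us X x p
  ...   | inj₁ q = inj₁ (∈-++⁺ʳ (fvT t) q)
  ...   | inj₂ (inj₁ q) = inj₂ (inj₁ (∈-++⁺ʳ (fvT u) q))
  ...   | inj₂ (inj₂ q) = inj₂ (inj₂ q)

  fvF-exClose : ∀ xs F x → x ∈ fvF (exClose xs F) → x ∈ fvF F × x ∉ xs
  fvF-exClose [] F x m = m , λ ()
  fvF-exClose (y ∷ xs) F x m with ∈-filter⁻ (λ z → ¬? (z ≟ y)) {xs = fvF (exClose xs F)} m
  ... | m' , x≢y with fvF-exClose xs F x m'
  ...   | inF , x∉xs = inF , λ { (here e) → x≢y e ; (there q) → x∉xs q }

  fvF-⊤f : ∀ x → x ∉ fvF ⊤f
  fvF-⊤f x m = [ noVars , noVars ]′ (∈-++⁻ (fvT cstT) m)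
    where
      noVars : x ∉ fvV (subst (Vec Term) (sym cst-const) [])
      noVars = closed (sym cst-const)
        where
          closed : ∀ {a} (e : 0 ≡ a) → x ∉ fvV (subst (Vec Term) e [])
          closed refl ()

  fvF-conj : ∀ cs x → x ∈ fvF (conj cs) → Any (λ c → x ∈ fvF c) cs
  fvF-conj [] x m = ⊥-elim (fvF-⊤f x m)
  fvF-conj (c ∷ []) x m = here m
  fvF-conj (c ∷ c' ∷ cs) x m = [ here , (λ p → there (fvF-conj (c' ∷ cs) x p)) ]′ (∈-++⁻ (fvF c) m)

  fvF-∃₋ : ∀ G F x → x ∈ fvF (∃₋ G F) → x ∈ fvGoal G
  fvF-∃₋ G F x m with fvF-exClose (filter (λ z → ¬? (z ∈? fvGoal G)) (deduplicate _≟_ (fvF F))) F x m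
  ... | inF , x∉ with x ∈? fvGoal G
  ...   | yes p = p
  ...   | no q = ⊥-elim (x∉ (∈-filter⁺ (λ z → ¬? (z ∈? fvGoal G)) (∈-deduplicate⁺ _≟_ inF) q))

  fvT-renT⁻ : ∀ σ t x → x ∈ fvT (renT σ t) → Σ Var (λ y → y ∈ fvT t × σ y ≡ x)
  fvV-renV⁻ : ∀ σ {n} (ts : Vec Term n) x → x ∈ fvV (renV σ ts) → Σ Var (λ y → y ∈ fvV ts × σ y ≡ x)
  fvT-renT⁻ σ (var z) x (here refl) = z , here refl , refl
  fvT-renT⁻ σ (fn f ts) x m = fvV-renV⁻ σ ts x m
  fvV-renV⁻ σ (t ∷ ts) x m with ∈-++⁻ (fvT (renT σ t)) m
  ... | inj₁ p = let (y , q , e) = fvT-renT⁻ σ t x p in y , ∈-++⁺ˡ q , e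
  ... | inj₂ p = let (y , q , e) = fvV-renV⁻ σ ts x p in y , ∈-++⁺ʳ (fvT t) q , e

  fvT-renT⁺ : ∀ σ t y → y ∈ fvT t → σ y ∈ fvT (renT σ t)
  fvV-renV⁺ : ∀ σ {n} (ts : Vec Term n) y → y ∈ fvV ts → σ y ∈ fvV (renV σ ts)
  fvT-renT⁺ σ (var z) y (here refl) = here refl
  fvT-renT⁺ σ (fn f ts) y m = fvV-renV⁺ σ ts y m
  fvV-renV⁺ σ (t ∷ ts) y m with ∈-++⁻ (fvT t) m
  ... | inj₁ p = ∈-++⁺ˡ (fvT-renT⁺ σ t y p)
  ... | inj₂ p = ∈-++⁺ʳ (fvT (renT σ t)) (fvV-renV⁺ σ ts y p)

  preimage-++ : ∀ {xs ys xs' ys' : List Var} (σ : Var → Var) x →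
                (x ∈ xs' → Σ Var (λ y → y ∈ xs × σ y ≡ x)) → (x ∈ ys' → Σ Var (λ y → y ∈ ys × σ y ≡ x)) →
                x ∈ xs' ++ ys' → Σ Var (λ y → y ∈ xs ++ ys × σ y ≡ x)
  preimage-++ {xs} {ys} {xs'} σ x f g m with ∈-++⁻ xs' m
  ... | inj₁ p = let (y , q , e) = f p in y , ∈-++⁺ˡ q , e
  ... | inj₂ p = let (y , q , e) = g p in y , ∈-++⁺ʳ xs q , e

  image-++ : ∀ {xs ys xs' ys' : List Var} (σ : Var → Var) y →
             (y ∈ xs → σ y ∈ xs') → (y ∈ ys → σ y ∈ ys') → y ∈ xs ++ ys → σ y ∈ xs' ++ ys'
  image-++ {xs} {ys} {xs'} σ y f g m with ∈-++⁻ xs m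
  ... | inj₁ p = ∈-++⁺ˡ (f p)
  ... | inj₂ p = ∈-++⁺ʳ xs' (g p)

  module _ (σ : Var → Var) (inj : Injective _≡_ _≡_ σ) where
    fvF-renF⁻ : ∀ F x → x ∈ fvF (renF σ F) → Σ Var (λ y → y ∈ fvF F × σ y ≡ x)
    fvF-renF⁻-binder : ∀ z F x → x ∈ filter (λ y → ¬? (y ≟ σ z)) (fvF (renF σ F)) →
                       Σ Var (λ y → y ∈ filter (λ y → ¬? (y ≟ z)) (fvF F) × σ y ≡ x)
    fvF-renF⁻ (cat p ts) x m = fvV-renV⁻ σ ts x m
    fvF-renF⁻ (t ≐ u) x m = preimage-++ σ x (fvT-renT⁻ σ t x) (fvT-renT⁻ σ u x) m
    fvF-renF⁻ (¬f F) x m = fvF-renF⁻ F x m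
    fvF-renF⁻ (F ∧f G) x m = preimage-++ σ x (fvF-renF⁻ F x) (fvF-renF⁻ G x) m
    fvF-renF⁻ (F ∨f G) x m = preimage-++ σ x (fvF-renF⁻ F x) (fvF-renF⁻ G x) m
    fvF-renF⁻ (F ⇒f G) x m = preimage-++ σ x (fvF-renF⁻ F x) (fvF-renF⁻ G x) m
    fvF-renF⁻ (∃f z F) x m = fvF-renF⁻-binder z F x m
    fvF-renF⁻ (∀f z F) x m = fvF-renF⁻-binder z F x m

    fvF-renF⁻-binder z F x m with ∈-filter⁻ (λ y → ¬? (y ≟ σ z)) {xs = fvF (renF σ F)} m
    ... | m' , x≢σz with fvF-renF⁻ F x m'
    ...   | y , q , refl = y , ∈-filter⁺ (λ y → ¬? (y ≟ z)) q (λ e → x≢σz (cong σ e)) , refl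

    fvF-renF⁺ : ∀ F y → y ∈ fvF F → σ y ∈ fvF (renF σ F)
    fvF-renF⁺-binder : ∀ z F y → y ∈ filter (λ y → ¬? (y ≟ z)) (fvF F) →
                       σ y ∈ filter (λ y → ¬? (y ≟ σ z)) (fvF (renF σ F))
    fvF-renF⁺ (cat p ts) y m = fvV-renV⁺ σ ts y m
    fvF-renF⁺ (t ≐ u) y m = image-++ σ y (fvT-renT⁺ σ t y) (fvT-renT⁺ σ u y) m
    fvF-renF⁺ (¬f F) y m = fvF-renF⁺ F y m
    fvF-renF⁺ (F ∧f G) y m = image-++ σ y (fvF-renF⁺ F y) (fvF-renF⁺ G y) m
    fvF-renF⁺ (F ∨f G) y m = image-++ σ y (fvF-renF⁺ F y) (fvF-renF⁺ G y) m
    fvF-renF⁺ (F ⇒f G) y m = image-++ σ y (fvF-renF⁺ F y) (fvF-renF⁺ G y) m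
    fvF-renF⁺ (∃f z F) y m = fvF-renF⁺-binder z F y m
    fvF-renF⁺ (∀f z F) y m = fvF-renF⁺-binder z F y m

    fvF-renF⁺-binder z F y m with ∈-filter⁻ (λ y → ¬? (y ≟ z)) {xs = fvF F} m
    ... | m' , y≢z = ∈-filter⁺ (λ y → ¬? (y ≟ σ z)) (fvF-renF⁺ F y m') (λ e → y≢z (inj e))

    fvL-renL⁻ : ∀ L x → x ∈ fvL (renL σ L) → Σ Var (λ y → y ∈ fvL L × σ y ≡ x)
    fvL-renL⁻ (pos (p , ts)) = fvV-renV⁻ σ ts
    fvL-renL⁻ (neg (p , ts)) = fvV-renV⁻ σ ts

    fvL-renL⁺ : ∀ L y → y ∈ fvL L → σ y ∈ fvL (renL σ L)
    fvL-renL⁺ (pos (p , ts)) = fvV-renV⁺ σ ts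
    fvL-renL⁺ (neg (p , ts)) = fvV-renV⁺ σ ts

    fvLits-renL⁻ : ∀ Ls x → x ∈ fvLits (map (renL σ) Ls) → Σ Var (λ y → y ∈ fvLits Ls × σ y ≡ x)
    fvLits-renL⁻ (L ∷ Ls) x m = preimage-++ σ x (fvL-renL⁻ L x) (fvLits-renL⁻ Ls x) m

    fvLits-renL⁺ : ∀ Ls y → y ∈ fvLits Ls → σ y ∈ fvLits (map (renL σ) Ls)
    fvLits-renL⁺ (L ∷ Ls) y m = image-++ σ y (fvL-renL⁺ L y) (fvLits-renL⁺ Ls y) m

    fvPosLits-renL⁺ : ∀ Ls y → y ∈ fvPosLits Ls → σ y ∈ fvPosLits (map (renL σ) Ls)
    fvPosLits-renL⁺ (pos (p , ts) ∷ Ls) y m = image-++ σ y (fvV-renV⁺ σ ts y) (fvPosLits-renL⁺ Ls y) m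
    fvPosLits-renL⁺ (neg A ∷ Ls) y m = fvPosLits-renL⁺ Ls y m

    fvNegLits-renL⁻ : ∀ Ls x → x ∈ fvNegLits (map (renL σ) Ls) → Σ Var (λ y → y ∈ fvNegLits Ls × σ y ≡ x)
    fvNegLits-renL⁻ (neg (p , ts) ∷ Ls) x m = preimage-++ σ x (fvV-renV⁻ σ ts x) (fvNegLits-renL⁻ Ls x) m
    fvNegLits-renL⁻ (pos A ∷ Ls) x m = fvNegLits-renL⁻ Ls x m

    fvRule-renRule⁻ : ∀ r x → x ∈ fvRule (renRule σ r) → Σ Var (λ y → y ∈ fvRule r × σ y ≡ x)
    fvRule-renRule⁻ (rule (p , us) C K) x =
      preimage-++ σ x (fvV-renV⁻ σ us x) (preimage-++ σ x (fvF-renF⁻ C x) (fvLits-renL⁻ K x))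

    fvRule-renRule⁺ : ∀ r y → y ∈ fvRule r → σ y ∈ fvRule (renRule σ r)
    fvRule-renRule⁺ (rule (p , us) C K) y =
      image-++ σ y (fvV-renV⁺ σ us y) (image-++ σ y (fvF-renF⁺ C y) (fvLits-renL⁺ K y))


module GroundSyntax (S : Sig) where
  open Hybrid S
  open FormulaSemantics S
  open FreeVariables S

  GAgree : (Var → GTerm) → (Var → GTerm) → List Var → Set
  GAgree θ θ' xs = ∀ x → x ∈ xs → θ x ≡ θ' x

  gagree-++ˡ : ∀ {θ θ'} xs {ys} → GAgree θ θ' (xs ++ ys) → GAgree θ θ' xs
  gagree-++ˡ xs a x m = a x (∈-++⁺ˡ m)

  gagree-++ʳ : ∀ {θ θ'} xs {ys} → GAgree θ θ' (xs ++ ys) → GAgree θ θ' ys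
  gagree-++ʳ xs a x m = a x (∈-++⁺ʳ xs m)

  gT-agree : ∀ θ θ' t → GAgree θ θ' (fvT t) → gT θ t ≡ gT θ' t
  gV-agree : ∀ θ θ' {n} (ts : Vec Term n) → GAgree θ θ' (fvV ts) → gV θ ts ≡ gV θ' ts
  gT-agree θ θ' (var x) a = a x (here refl)
  gT-agree θ θ' (fn f ts) a = cong (gfn f) (gV-agree θ θ' ts a)
  gV-agree θ θ' [] a = refl
  gV-agree θ θ' (t ∷ ts) a =
    cong₂ _∷_ (gT-agree θ θ' t (gagree-++ˡ (fvT t) a)) (gV-agree θ θ' ts (gagree-++ʳ (fvT t) a))

  gL-agree : ∀ θ θ' L → GAgree θ θ' (fvL L) → gL θ L ≡ gL θ' L
  gL-agree θ θ' (pos (p , ts)) a = cong (λ us → gpos (p , us)) (gV-agree θ θ' ts a)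
  gL-agree θ θ' (neg (p , ts)) a = cong (λ us → gneg (p , us)) (gV-agree θ θ' ts a)

  gT-renT : ∀ θ σ t → gT θ (renT σ t) ≡ gT (θ ∘ σ) t
  gV-renV : ∀ θ σ {n} (ts : Vec Term n) → gV θ (renV σ ts) ≡ gV (θ ∘ σ) ts
  gT-renT θ σ (var x) = refl
  gT-renT θ σ (fn f ts) = cong (gfn f) (gV-renV θ σ ts)
  gV-renV θ σ [] = refl
  gV-renV θ σ (t ∷ ts) = cong₂ _∷_ (gT-renT θ σ t) (gV-renV θ σ ts)

  gL-renL : ∀ θ σ L → gL θ (renL σ L) ≡ gL (θ ∘ σ) L
  gL-renL θ σ (pos (p , ts)) = cong (λ us → gpos (p , us)) (gV-renV θ σ ts)
  gL-renL θ σ (neg (p , ts)) = cong (λ us → gneg (p , us)) (gV-renV θ σ ts)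

  embed-closed : ∀ g z → z ∉ fvT (embed g)
  embedV-closed : ∀ {n} (gs : Vec GTerm n) z → z ∉ fvV (embedV gs)
  embed-closed (gfn f gs) z m = embedV-closed gs z m
  embedV-closed (g ∷ gs) z m with ∈-++⁻ (fvT (embed g)) m
  ... | inj₁ p = embed-closed g z p
  ... | inj₂ p = embedV-closed gs z p

  override : (L : List Var) → (∀ x → x ∈ L → GTerm) → (Var → GTerm) → Var → GTerm
  override L f θ x with x ∈? L
  ... | yes m = f x m
  ... | no _ = θ x

  override-∈ : ∀ L f θ x v → x ∈ L → (∀ m → f x m ≡ v) → override L f θ x ≡ v
  override-∈ L f θ x v m h with x ∈? L
  ... | yes m' = h m'
  ... | no x∉L = ⊥-elim (x∉L m)

  override-∉ : ∀ L f θ x → x ∉ L → override L f θ x ≡ θ x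
  override-∉ L f θ x x∉L with x ∈? L
  ... | yes m = ⊥-elim (x∉L m)
  ... | no _ = refl

  variant-valuation : ∀ σ → Injective _≡_ _≡_ σ → ∀ r (θr θ : Var → GTerm) → Σ (Var → GTerm) (λ θ' →
                        (∀ y → y ∈ fvRule r → θ' (σ y) ≡ θr y) × (∀ x → x ∉ fvRule (renRule σ r) → θ' x ≡ θ x))
  variant-valuation σ inj r θr θ = θ' , onRule , override-∉ Lσ fromRule θ
    where
      Lσ = fvRule (renRule σ r)
      fromRule : ∀ x → x ∈ Lσ → GTerm
      fromRule x m = θr (proj₁ (fvRule-renRule⁻ σ inj r x m))
      θ' = override Lσ fromRule θ
      onRule : ∀ y → y ∈ fvRule r → θ' (σ y) ≡ θr y
      onRule y m = override-∈ Lσ fromRule θ (σ y) (θr y) (fvRule-renRule⁺ σ inj r y m)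
                     (λ m' → cong θr (inj (proj₂ (proj₂ (fvRule-renRule⁻ σ inj r (σ y) m')))))

  module Ground (M : Structure) where
    open Structure M

    evg : GTerm → Carrier
    evgV : ∀ {n} → Vec GTerm n → Vec Carrier n
    evg (gfn f gs) = fun f (evgV gs)
    evgV [] = []
    evgV (g ∷ gs) = evg g ∷ evgV gs

    evT-embed : ∀ ρ g → evT M ρ (embed g) ≡ evg g
    evV-embedV : ∀ ρ {n} (gs : Vec GTerm n) → evV M ρ (embedV gs) ≡ evgV gs
    evT-embed ρ (gfn f gs) = cong (fun f) (evV-embedV ρ gs)
    evV-embedV ρ [] = refl
    evV-embedV ρ (g ∷ gs) = cong₂ _∷_ (evT-embed ρ g) (evV-embedV ρ gs)

    evT-gT : ∀ θ t → evT M (evg ∘ θ) t ≡ evg (gT θ t)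
    evV-gV : ∀ θ {n} (ts : Vec Term n) → evV M (evg ∘ θ) ts ≡ evgV (gV θ ts)
    evT-gT θ (var x) = refl
    evT-gT θ (fn f ts) = cong (fun f) (evV-gV θ ts)
    evV-gV θ [] = refl
    evV-gV θ (t ∷ ts) = cong₂ _∷_ (evT-gT θ t) (evV-gV θ ts)

    Sat : (Var → GTerm) → Form → Set
    Sat θ F = ⟦_⟧ M F (evg ∘ θ)

    captureFree-ground : ∀ θ → CaptureFree M (embed ∘ θ)
    captureFree-ground θ y = inj₂ (embed-closed (θ y))

    ⊨[]→Sat : ∀ θ F → M ⊨ (F [ θ ]F) → Sat θ F
    ⊨[]→Sat θ F h = ⟦⟧-≗ M F _ _ (λ x → evT-embed ρ₀ (θ x)) (proj₁ (⟦⟧-subF M (embed ∘ θ) (captureFree-ground θ) F ρ₀) (h ρ₀))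
      where ρ₀ = λ _ → evg (θ 0)

    Sat→⊨[] : ∀ θ F → Sat θ F → M ⊨ (F [ θ ]F)
    Sat→⊨[] θ F h ρ = proj₂ (⟦⟧-subF M (embed ∘ θ) (captureFree-ground θ) F ρ)
                        (⟦⟧-≗ M F _ _ (λ x → sym (evT-embed ρ (θ x))) h)

module FreeTermAlgebra (em : ExcludedMiddle 0ℓ) (S : Sig) where
  open Hybrid S
  open GroundSyntax S

  range : ℕ → (n : ℕ) → Vec ℕ n
  range k zero = []
  range k (suc n) = k ∷ range (suc k) n

  range-lookup : ∀ k n (i : Fin n) → lookup (range k n) i ≡ k + toℕ i
  range-lookup k (suc n) fz = sym (+-identityʳ k)
  range-lookup k (suc n) (fs i) = trans (range-lookup (suc k) n i) (sym (+-suc k (toℕ i)))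

  range-++ : ∀ k n m → vtoList (range k n) ++ vtoList (range (k + n) m) ≡ vtoList (range k (n + m))
  range-++ k zero m = cong (vtoList ∘ (λ j → range j m)) (+-identityʳ k)
  range-++ k (suc n) m = cong (k ∷_) (trans (cong (λ j → vtoList (range (suc k) n) ++ vtoList (range j m)) (+-suc k n))
                                              (range-++ (suc k) n m))

  range-above : ∀ j k n → j ≤ k → All (j ≢_) (vtoList (range (suc k) n))
  range-above j k zero _ = []
  range-above j k (suc n) j≤k = <⇒≢ (s≤s j≤k) ∷ range-above j (suc k) n (≤-trans j≤k (n≤1+n k))

  range-unique : ∀ k n → AllPairs _≢_ (vtoList (range k n))
  range-unique k zero = []
  range-unique k (suc n) = range-above k k n ≤-refl ∷ range-unique (suc k) n

  nth : {A : Set} → List A → ℕ → A → A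
  nth [] i d = d
  nth (x ∷ xs) zero d = x
  nth (x ∷ xs) (suc i) d = nth xs i d

  nth-++ˡ : {A : Set} {n : ℕ} (ds : Vec A n) (L : List A) (i : Fin n) (d : A) →
            nth (vtoList ds ++ L) (toℕ i) d ≡ lookup ds i
  nth-++ˡ (x ∷ ds) L fz d = refl
  nth-++ˡ (x ∷ ds) L (fs i) d = nth-++ˡ ds L i d

  nth-++ʳ : {A : Set} {n m : ℕ} (ds : Vec A n) (es : Vec A m) (i : Fin m) (d : A) →
            nth (vtoList ds ++ vtoList es) (n + toℕ i) d ≡ lookup es i
  nth-++ʳ [] (x ∷ es) fz d = refl
  nth-++ʳ [] (x ∷ es) (fs i) d = nth-++ʳ [] es i d
  nth-++ʳ (x ∷ ds) es i d = nth-++ʳ ds es i d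

  lookup-ext : {A : Set} {n : ℕ} (v w : Vec A n) → (∀ i → lookup v i ≡ lookup w i) → v ≡ w
  lookup-ext v w h = trans (sym (tabulate∘lookup v)) (trans (tabulate-cong h) (tabulate∘lookup w))

  module ModelOfCET (T : Theory) (IsC : Form → Set) (SA : StandingAssumptions T IsC) (M : Structure) (mod : Model T M) where
    open Structure M
    open StandingAssumptions SA
    open Ground M

    evV-vmap-var : ∀ ρ {n} (xs : Vec Var n) → evV M ρ (vmap var xs) ≡ vmap ρ xs
    evV-vmap-var ρ [] = refl
    evV-vmap-var ρ (x ∷ xs) = cong (ρ x ∷_) (evV-vmap-var ρ xs)

    ⟦conjEqs⟧⁻ : ∀ ρ {n} (xs ys : Vec Var n) → ⟦_⟧ M (conjEqs xs ys) ρ → ∀ i → ρ (lookup xs i) ≡ ρ (lookup ys i)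
    ⟦conjEqs⟧⁻ ρ (x ∷ []) (y ∷ []) h fz = h
    ⟦conjEqs⟧⁻ ρ (x ∷ x' ∷ xs) (y ∷ y' ∷ ys) (h , _) fz = h
    ⟦conjEqs⟧⁻ ρ (x ∷ x' ∷ xs) (y ∷ y' ∷ ys) (_ , h) (fs i) = ⟦conjEqs⟧⁻ ρ (x' ∷ xs) (y' ∷ ys) h i

    -- To instantiate the CET axioms at argument vectors ds and es: distinct variables xs = 0…n-1 and
    -- ys = n…n+m-1, and an environment sending them to ds and es.
    module Instance {n m : ℕ} (ds : Vec Carrier n) (es : Vec Carrier m) where
      ρ : Var → Carrier
      ρ v = nth (vtoList ds ++ vtoList es) v (evg (gfn cst (subst (Vec GTerm) (sym cst-const) [])))

      xs : Vec Var n
      xs = range 0 n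

      ys : Vec Var m
      ys = range n m

      ρ-xs : vmap ρ xs ≡ ds
      ρ-xs = lookup-ext _ _ (λ i → trans (lookup-map i ρ xs)
               (trans (cong ρ (range-lookup 0 n i)) (nth-++ˡ ds (vtoList es) i _)))

      ρ-ys : vmap ρ ys ≡ es
      ρ-ys = lookup-ext _ _ (λ i → trans (lookup-map i ρ ys)
               (trans (cong ρ (range-lookup n m i)) (nth-++ʳ ds es i _)))

      evV-xs : evV M ρ (vmap var xs) ≡ ds
      evV-xs = trans (evV-vmap-var ρ xs) ρ-xs

      evV-ys : evV M ρ (vmap var ys) ≡ es
      evV-ys = trans (evV-vmap-var ρ ys) ρ-ys

      distinct : AllPairs _≢_ (vtoList xs ++ vtoList ys)
      distinct = subst (AllPairs _≢_) (sym (range-++ 0 n m)) (range-unique 0 (n + m))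

    fun-injective : ∀ f (ds es : Vec Carrier (arity f)) → fun f ds ≡ fun f es → ds ≡ es
    fun-injective f ds es e = lookup-ext ds es λ i →
        trans (cong (λ v → lookup v i) (sym ρ-xs))
          (trans (lookup-map i ρ xs)
            (trans (⟦conjEqs⟧⁻ ρ xs ys args≡ i)
              (trans (sym (lookup-map i ρ ys)) (cong (λ v → lookup v i) ρ-ys))))
      where
        open Instance ds es
        args≡ : ⟦_⟧ M (conjEqs xs ys) ρ
        args≡ = mod _ (cet-⊆ _ (cet-inj f xs ys distinct)) ρ
                  (trans (cong (fun f) evV-xs) (trans e (cong (fun f) (sym evV-ys))))

    fun-disjoint : ∀ f g (ds : Vec Carrier (arity f)) (es : Vec Carrier (arity g)) → f ≢ g → fun f ds ≢ fun g es
    fun-disjoint f g ds es f≢g e =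
      mod _ (cet-⊆ _ (cet-clash f g xs ys distinct f≢g)) ρ
        (trans (cong (fun f) evV-xs) (trans e (cong (fun g) (sym evV-ys))))
      where open Instance ds es

    -- Function symbols need not have decidable equality, hence excluded middle.
    fun-≡⁻ : ∀ f g (ds : Vec Carrier (arity f)) (es : Vec Carrier (arity g)) → fun f ds ≡ fun g es →
             Σ (f ≡ g) (λ { refl → ds ≡ es })
    fun-≡⁻ f g ds es e with em {f ≡ g}
    ... | yes refl = refl , fun-injective f ds es e
    ... | no f≢g = ⊥-elim (fun-disjoint f g ds es f≢g e)

    evg-injective : ∀ g g' → evg g ≡ evg g' → g ≡ g'
    evgV-injective : ∀ {n} (gs gs' : Vec GTerm n) → evgV gs ≡ evgV gs' → gs ≡ gs'
    evg-injective (gfn f gs) (gfn f' gs') e with fun-≡⁻ f f' (evgV gs) (evgV gs') e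
    ... | refl , e' = cong (gfn f) (evgV-injective gs gs' e')
    evgV-injective [] [] e = refl
    evgV-injective (g ∷ gs) (g' ∷ gs') e =
      cong₂ _∷_ (evg-injective g g' (proj₁ (∷-injective e))) (evgV-injective gs gs' (proj₂ (∷-injective e)))

module Iteration (S : Sig) where
  open Hybrid S

  _⊆I_ : Interp → Interp → Set
  I ⊆I J = ∀ l → I l → J l

  module _ (Q : GRule → Set) where
    LM-mono : ∀ {N₁ N₂ : GAtom → Set} → (∀ B → N₁ B → N₂ B) → ∀ {A} → LM Q N₁ A → LM Q N₂ A
    LM-mono-All : ∀ {N₁ N₂ : GAtom → Set} → (∀ B → N₁ B → N₂ B) →
                  ∀ {bd} → All (litH (LM Q N₁) N₁) bd → All (litH (LM Q N₂) N₂) bd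
    LM-mono h (derive q ps) = derive q (LM-mono-All h ps)
    LM-mono-All h [] = []
    LM-mono-All h {gpos A ∷ _} (p ∷ ps) = LM-mono h p ∷ LM-mono-All h ps
    LM-mono-All h {gneg A ∷ _} (p ∷ ps) = h A p ∷ LM-mono-All h ps

    Ψ-mono : ∀ {I J} → I ⊆I J → Ψ Q I ⊆I Ψ Q J
    Ψ-mono h (gpos A) p = LM-mono (λ B → h (gneg B)) p
    Ψ-mono h (gneg A) p = λ q → p (LM-mono (λ B ¬J ¬I → ¬J (h (gpos B) ¬I)) q)

    Ψ↑-mono : ∀ {a b} → a ≤o b → Ψ↑ Q a ⊆I Ψ↑ Q b
    Ψ↑-mono ≤o-zero l ()
    Ψ↑-mono ≤o-refl l p = p
    Ψ↑-mono (≤o-trans h h') l p = Ψ↑-mono h' l (Ψ↑-mono h l p)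
    Ψ↑-mono (≤o-suc h) l p = Ψ-mono (Ψ↑-mono h) l p
    Ψ↑-mono (≤o-cocone n h) l p = n , Ψ↑-mono h l p
    Ψ↑-mono (≤o-limiting h) l (n , p) = Ψ↑-mono (h n) l p

    Ψ↑-⊆-suc : ∀ a → Ψ↑ Q a ⊆I Ψ↑ Q (os a)
    Ψ↑-⊆-suc oz l ()
    Ψ↑-⊆-suc (os a) l p = Ψ-mono (Ψ↑-⊆-suc a) l p
    Ψ↑-⊆-suc (olim f) l (n , p) = Ψ-mono (λ l' q → n , q) l (Ψ↑-⊆-suc (f n) l p)

module Soundness (em : ExcludedMiddle 0ℓ) (S : Sig) where
  open Hybrid S
  open FormulaSemantics S
  open FreeVariables S
  open GroundSyntax S
  open FreeTermAlgebra em S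
  open Iteration S

  maxV : List ℕ → ℕ
  maxV [] = 0
  maxV (x ∷ xs) = x ⊔ maxV xs

  maxV-≤ : ∀ xs x → x ∈ xs → x ≤ maxV xs
  maxV-≤ (y ∷ xs) x (here refl) = m≤m⊔n y (maxV xs)
  maxV-≤ (y ∷ xs) x (there m) = ≤-trans (maxV-≤ xs x m) (m≤n⊔m y (maxV xs))

  maxG : List Goal → ℕ
  maxG [] = 0
  maxG (g ∷ gs) = maxV (fvGoal g) ⊔ maxG gs

  maxG-≤ : ∀ gs g x → g ∈ gs → x ∈ fvGoal g → x ≤ maxG gs
  maxG-≤ (g ∷ gs) g x (here refl) m = ≤-trans (maxV-≤ (fvGoal g) x m) (m≤m⊔n _ (maxG gs))
  maxG-≤ (h ∷ gs) g x (there p) m = ≤-trans (maxG-≤ gs g x p m) (m≤n⊔m _ (maxG gs))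

  ≼⇒∈pathGoals : ∀ {t} {m n : Node t} → m ≼ n → labelAt m ∈ pathGoals n
  ≼⇒∈pathGoals {n = here} here≼ = here refl
  ≼⇒∈pathGoals {n = there c n} here≼ = here refl
  ≼⇒∈pathGoals (there≼ p) = there (≼⇒∈pathGoals p)

  module Program (T : Theory) (IsC : Form → Set) (SA : StandingAssumptions T IsC)
                 (P : Rule → Set) (M0 : Structure) (mod : Model T M0) where
    open Trees T IsC P
    open Structure M0
    open Ground M0
    open ModelOfCET T IsC SA M0 mod

    Q : GRule → Set
    Q = P /M M0

    ∃₋-elim : ∀ G F ρ → ⟦_⟧ M0 (∃₋ G F) ρ → Σ (Env M0) (λ ρ' → ⟦_⟧ M0 F ρ' × Agree M0 ρ' ρ (fvGoal G))
    ∃₋-elim G F ρ h with exClose-elim M0 _ F ρ h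
    ... | ρ' , h' , a = ρ' , h' , λ y m →
            a y (λ m' → proj₂ (∈-filter⁻ (λ x → ¬? (x ∈? fvGoal G)) {xs = deduplicate _≟_ (fvF F)} m') m)

    ∃₋-intro : ∀ G F θ θ' → Sat θ' F → GAgree θ' θ (fvGoal G) → Sat θ (∃₋ G F)
    ∃₋-intro G F θ θ' h a = exClose-intro M0 _ F (evg ∘ θ) (evg ∘ θ') a' h
      where
        a' : ∀ y → y ∉ _ → y ∈ fvF F → evg (θ' y) ≡ evg (θ y)
        a' y y∉ m with y ∈? fvGoal G
        ... | yes p = cong evg (a y p)
        ... | no q = ⊥-elim (y∉ (∈-filter⁺ (λ x → ¬? (x ∈? fvGoal G)) (∈-deduplicate⁺ _≟_ m) q))

    Holds3-mono : ∀ {I J} → I ⊆I J → ∀ G θ → Holds3 M0 I G θ → Holds3 M0 J G θ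
    Holds3-mono h G θ (s , a) = s , All.map (h _) a

    HoldsNeg3-mono : ∀ {I J} → I ⊆I J → ∀ G θ → HoldsNeg3 M0 I G θ → HoldsNeg3 M0 J G θ
    HoldsNeg3-mono h G θ (inj₁ x) = inj₁ x
    HoldsNeg3-mono h G θ (inj₂ a) = inj₂ (Any.map (h _) a)

    fresh-variant : ∀ gs r → Σ (ℕ → ℕ) (λ σ → Injective _≡_ _≡_ σ × Fresh (renRule σ r) gs)
    fresh-variant gs r = (N +_) , +-cancelˡ-≡ N _ _ , fresh
      where
        N = suc (maxG gs)
        fresh : Fresh (renRule (N +_) r) gs
        fresh x m with fvRule-renRule⁻ (N +_) (+-cancelˡ-≡ N _ _) r x m
        ... | y , _ , refl = All.tabulate (λ {g} g∈gs x∈g →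
                <-irrefl refl (≤-<-trans (maxG-≤ gs g (N + y) g∈gs x∈g) (s≤s (m≤m+n (maxG gs) y))))

    GroundableLeaves : Tree → Set₁
    GroundableLeaves t = ∀ (n : Node t) → Successful (labelAt n) → ∀ ρ θ → ⟦_⟧ M0 (gcon (labelAt n)) ρ →
                         Agree M0 ρ (evg ∘ θ) (fvGoal (label t)) →
                         Σ (Var → GTerm) (λ θ' → Sat θ' (gcon (labelAt n)) × GAgree θ' θ (fvGoal (label t)))

    fresh-apart : ∀ pre s {Ls L Ls'} → lits (label s) ≡ Ls ++ L ∷ Ls' → ∀ r' → Fresh r' (pre ++ label s ∷ []) →
                  ∀ x → x ∈ fvRule r' → x ∉ fvF (gcon (label s)) ++ fvLits (Ls ++ L ∷ Ls')
    fresh-apart pre s eq r' fresh x m m' = All.lookup (fresh x m) (∈-++⁺ʳ pre (here refl))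
                                             (subst (λ ls → x ∈ fvF (gcon (label s)) ++ fvLits ls) (sym eq) m')

    negAnswer-refutes : ∀ t C → (na : NegAnswer t C) → ∀ θ → Sat θ C →
                        ∀ m → proj₁ na m → ¬ Sat θ (∃₋ (label t) (gcon (labelAt m)))
    negAnswer-refutes t C (Sn , _ , inj₁ (cs , enum , refl)) θ satC m m∈Sn =
      All.lookup (All.map⁻ (⟦conj⟧⁻ M0 _ (evg ∘ θ) satC)) (proj₂ (enum (gcon (labelAt m))) (m , m∈Sn , refl))
    negAnswer-refutes t C (Sn , _ , inj₂ (_ , _ , _ , refutes)) θ satC m m∈Sn = refutes m m∈Sn M0 mod (evg ∘ θ) satC

    module Answers (k : Ord) where
      FalseAt : GAtom → Set
      FalseAt B = Ψ↑ Q k (gneg B)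

      -- truth in Ψ↑ (os k), with negative literals taken already false at stage k
      TrueNext : GLit → Set
      TrueNext = litH (LM Q FalseAt) FalseAt

      TrueNextGoal : (Var → GTerm) → Goal → Set
      TrueNextGoal θ g = Sat θ (gcon g) × All (λ L → TrueNext (gL θ L)) (lits g)

      SoundNegAnswer : Goal → Form → Set₁
      SoundNegAnswer G C = Lift (lsuc 0ℓ) (∀ θ → Sat θ C → HoldsNeg3 M0 (Ψ↑ Q k) G θ)

      TrueNext-renL : ∀ θ σ K → All (λ L → TrueNext (gL θ L)) (map (renL σ) K) → All TrueNext (map (gL (θ ∘ σ)) K)
      TrueNext-renL θ σ [] [] = []
      TrueNext-renL θ σ (L ∷ K) (p ∷ ps) = subst TrueNext (gL-renL θ σ L) p ∷ TrueNext-renL θ σ K ps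

      -- The child comes from a variant r σ of r; under θ ∘ σ the rule r is a rule of P/M0 with a true body,
      -- so the selected atom is derivable.
      expansion-reflects : ∀ θ gs Ls Ls' C A r G'' → P r → Expands gs Ls Ls' C A r G'' → TrueNextGoal θ G'' →
                           Sat θ C × All (λ L → TrueNext (gL θ L)) (Ls ++ pos A ∷ Ls')
      expansion-reflects θ gs Ls Ls' C (p , ts) (rule (p , us) C₀ K) G'' Pr (_ , (σ , inj , refl) , _ , der , _) (sat , true)
        with ⟦eqsF⟧⁻ M0 ts (renV σ us) (C ∧f renF σ C₀) (evg ∘ θ) sat
      ... | ts≡us , (satC , satC₀) = satC , All.++⁺ trueLs (headTrue ∷ trueLs')
        where
          trueLs = proj₁ (All.++⁻ Ls true)
          trueK = proj₁ (All.++⁻ (map (renL σ) K) (proj₂ (All.++⁻ Ls true)))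
          trueLs' = proj₂ (All.++⁻ (map (renL σ) K) (proj₂ (All.++⁻ Ls true)))
          gts : gV θ ts ≡ gV (θ ∘ σ) us
          gts = trans (evgV-injective _ _ (trans (sym (evV-gV θ ts)) (trans ts≡us (evV-gV θ (renV σ us)))))
                      (gV-renV θ σ us)
          instanceInQ : Q (grule (p , gV (θ ∘ σ) us) (map (gL (θ ∘ σ)) K))
          instanceInQ = rule (p , us) C₀ K , Pr , θ ∘ σ ,
                        Sat→⊨[] (θ ∘ σ) C₀ (proj₁ (⟦⟧-renF M0 σ inj C₀ (evg ∘ θ)) satC₀) , refl
          headTrue : LM Q FalseAt (p , gV θ ts)
          headTrue = subst (λ v → LM Q FalseAt (p , v)) (sym gts) (derive instanceInQ (TrueNext-renL θ σ K trueK))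

      child→parent : ∀ θ s gs → NodeCond (TSel SoundNegAnswer) s gs → (c : Child s) →
                     TrueNextGoal θ (label (child s c)) → TrueNextGoal θ (label s)
      child→parent θ s gs (inj₁ (_ , noChild)) c h = ⊥-elim (noChild c)
      child→parent θ s gs (inj₂ (Ls , pos A , Ls' , eq , (ro , Pro , _ , exps , _))) c h
        with expansion-reflects θ gs Ls Ls' (gcon (label s)) A (ro c) (label (child s c)) (Pro c) (exps c) h
      ... | sat , true = sat , subst (All (λ L → TrueNext (gL θ L))) (sym eq) true
      child→parent θ s gs (inj₂ (Ls , neg A , Ls' , eq , inj₁ noChild)) c h = ⊥-elim (noChild c)
      child→parent θ s gs (inj₂ (Ls , neg A , Ls' , eq , inj₂ ((c₀ , unique) , C' , lift sound , _ , eql))) c h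
        = sat , subst (All (λ L → TrueNext (gL θ L))) (sym eq) (All.++⁺ (proj₁ true) (negTrue ∷ proj₂ true))
        where
          h₀ : TrueNextGoal θ (goal (C' ∧f gcon (label s)) (Ls ++ Ls'))
          h₀ = subst (TrueNextGoal θ) (trans (cong (λ c → label (child s c)) (unique c)) eql) h
          sat = proj₂ (proj₁ h₀)
          true = All.++⁻ Ls (proj₂ h₀)
          negTrue : TrueNext (gL θ (neg A))
          negTrue with sound θ (proj₁ (proj₁ h₀))
          ... | inj₁ unsat = ⊥-elim (unsat (Sat→⊨[] θ (gcon (label s)) sat))
          ... | inj₂ (here p) = p

      node→root : ∀ θ t → (∀ (m : Node t) → Σ (List Goal) (λ gs → NodeCond (TSel SoundNegAnswer) (subAt m) gs)) →
                  (n : Node t) → TrueNextGoal θ (labelAt n) → TrueNextGoal θ (label t)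
      node→root θ t cond here h = h
      node→root θ t cond (there c n) h =
        child→parent θ t (proj₁ (cond here)) (proj₂ (cond here)) c (node→root θ (child t c) (λ m → cond (there c m)) n h)

      TrueNext⊆Ψ↑ : ∀ l → TrueNext l → Ψ↑ Q (os k) l
      TrueNext⊆Ψ↑ (gpos B) p = p
      TrueNext⊆Ψ↑ (gneg B) p = Ψ↑-⊆-suc Q k (gneg B) p

      answer-sound : ∀ t → (∀ (m : Node t) → NodeCond (TSel SoundNegAnswer) (subAt m) (pathGoals m)) →
                     GroundableLeaves t → ∀ C → Answer t C → ∀ θ → M0 ⊨ (C [ θ ]F) →
                     Holds3 M0 (Ψ↑ Q (os k)) (label t) θ
      answer-sound t cond groundable C (ns , allSucc , refl) θ hC
        with ∃₋-elim (label t) (disj (map (gcon ∘ labelAt) ns)) (evg ∘ θ) (⊨[]→Sat θ C hC)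
      ... | ρ , satDisj , agree
        with find (Any.map⁻ (⟦disj⟧⁻ M0 (map (gcon ∘ labelAt) ns) ρ satDisj))
      ...   | n , n∈ns , satLeaf
        with groundable n (All.lookup allSucc n∈ns) ρ θ satLeaf agree
      ...     | θ' , satLeaf' , agree' = satRoot , litsRoot
        where
          leaf : TrueNextGoal θ' (labelAt n)
          leaf = satLeaf' , subst (All (λ L → TrueNext (gL θ' L))) (sym (All.lookup allSucc n∈ns)) []
          root : TrueNextGoal θ' (label t)
          root = node→root θ' t (λ m → pathGoals m , cond m) n leaf
          satRoot : M0 ⊨ (gcon (label t) [ θ ]F)
          satRoot = Sat→⊨[] θ (gcon (label t)) (⟦⟧-agree M0 (gcon (label t)) (evg ∘ θ') (evg ∘ θ)
                      (λ x m → cong evg (agree' x (∈-++⁺ˡ m))) (proj₁ root))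
          litsRoot : All (λ L → Ψ↑ Q (os k) (gL θ L)) (lits (label t))
          litsRoot = All.tabulate (λ {L} m → subst (Ψ↑ Q (os k))
                       (gL-agree θ' θ L (λ x mx → agree' x (∈-++⁺ʳ (fvF (gcon (label t))) (fvL⊆fvLits L _ x m mx))))
                       (TrueNext⊆Ψ↑ _ (All.lookup (proj₂ root) m)))

    module NegAnswers (k : Ord) where
      NotTrueAt : GAtom → Set
      NotTrueAt B = ¬ Ψ↑ Q k (gpos B)

      -- classically, not being false in Ψ↑ (os k)
      NotFalseNext : GLit → Set
      NotFalseNext = litH (LM Q NotTrueAt) NotTrueAt

      NotFalseLits : (Var → GTerm) → List Lit → Set
      NotFalseLits θ Ls = All (λ L → NotFalseNext (gL θ L)) Ls

      SoundAnswer : Goal → Form → Set₁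
      SoundAnswer G C = Lift (lsuc 0ℓ) (∀ θ → Sat θ C → Holds3 M0 (Ψ↑ Q k) G θ)

      derivationSize : ∀ {A} → LM Q NotTrueAt A → ℕ
      size : ∀ l → NotFalseNext l → ℕ
      sizeAll : ∀ {X : Set} (f : X → GLit) {xs} → All (λ x → NotFalseNext (f x)) xs → ℕ
      derivationSize (derive q ps) = suc (sizeAll id ps)
      size (gpos A) d = derivationSize d
      size (gneg A) _ = 1
      sizeAll f [] = 0
      sizeAll f {x ∷ xs} (p ∷ ps) = size (f x) p + sizeAll f ps

      sizeAll-++⁺ : ∀ {X : Set} (f : X → GLit) {xs ys} (a : All (λ x → NotFalseNext (f x)) xs)
                    (b : All (λ x → NotFalseNext (f x)) ys) → sizeAll f (All.++⁺ a b) ≡ sizeAll f a + sizeAll f b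
      sizeAll-++⁺ f [] b = refl
      sizeAll-++⁺ f {x ∷ xs} (p ∷ a) b = trans (cong (size (f x) p +_) (sizeAll-++⁺ f a b)) (sym (+-assoc (size (f x) p) _ _))

      sizeAll-++⁻ : ∀ {X : Set} (f : X → GLit) xs {ys} (e : All (λ x → NotFalseNext (f x)) (xs ++ ys)) →
                    sizeAll f e ≡ sizeAll f (proj₁ (All.++⁻ xs e)) + sizeAll f (proj₂ (All.++⁻ xs e))
      sizeAll-++⁻ f [] e = refl
      sizeAll-++⁻ f (x ∷ xs) (p ∷ e) = trans (cong (size (f x) p +_) (sizeAll-++⁻ f xs e)) (sym (+-assoc (size (f x) p) _ _))

      size-subst : ∀ {l l'} (eq : l ≡ l') (p : NotFalseNext l) → size l' (subst NotFalseNext eq p) ≡ size l p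
      size-subst refl p = refl

      NotFalseLits-transport : ∀ θ θ' Ls → (∀ L → L ∈ Ls → gL θ L ≡ gL θ' L) → (e : NotFalseLits θ Ls) →
                               Σ (NotFalseLits θ' Ls) (λ e' → sizeAll (gL θ') e' ≡ sizeAll (gL θ) e)
      NotFalseLits-transport θ θ' [] h [] = [] , refl
      NotFalseLits-transport θ θ' (L ∷ Ls) h (p ∷ e) with NotFalseLits-transport θ θ' Ls (λ L' m → h L' (there m)) e
      ... | e' , s = subst NotFalseNext (h L (here refl)) p ∷ e' , cong₂ _+_ (size-subst (h L (here refl)) p) s

      NotFalseLits-body : ∀ θ σ θr K → (∀ L → L ∈ K → gL θr L ≡ gL θ (renL σ L)) →
                          (ps : All NotFalseNext (map (gL θr) K)) →
                          Σ (NotFalseLits θ (map (renL σ) K)) (λ e → sizeAll (gL θ) e ≡ sizeAll id ps)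
      NotFalseLits-body θ σ θr [] h [] = [] , refl
      NotFalseLits-body θ σ θr (L ∷ K) h (p ∷ ps) with NotFalseLits-body θ σ θr K (λ L' m → h L' (there m)) ps
      ... | e , s = subst NotFalseNext (h L (here refl)) p ∷ e , cong₂ _+_ (size-subst (h L (here refl)) p) s

      NotFalseLits-resolvent : ∀ θ θ' σ θr Ls Ls' K →
        (∀ L → L ∈ Ls ++ Ls' → gL θ L ≡ gL θ' L) → (∀ L → L ∈ K → gL θr L ≡ gL θ' (renL σ L)) →
        (eL : NotFalseLits θ Ls) (eL' : NotFalseLits θ Ls') (ps : All NotFalseNext (map (gL θr) K)) →
        Σ (NotFalseLits θ' (Ls ++ map (renL σ) K ++ Ls'))
          (λ e → sizeAll (gL θ') e ≡ sizeAll (gL θ) eL + (sizeAll id ps + sizeAll (gL θ) eL'))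
      NotFalseLits-resolvent θ θ' σ θr Ls Ls' K onLits onBody eL eL' ps =
          All.++⁺ (proj₁ trL) (All.++⁺ (proj₁ bodyK) (proj₁ trL')) ,
          trans (sizeAll-++⁺ (gL θ') (proj₁ trL) (All.++⁺ (proj₁ bodyK) (proj₁ trL')))
            (cong₂ _+_ (proj₂ trL) (trans (sizeAll-++⁺ (gL θ') (proj₁ bodyK) (proj₁ trL'))
                                          (cong₂ _+_ (proj₂ bodyK) (proj₂ trL'))))
        where
          trL = NotFalseLits-transport θ θ' Ls (λ L m → onLits L (∈-++⁺ˡ m)) eL
          trL' = NotFalseLits-transport θ θ' Ls' (λ L m → onLits L (∈-++⁺ʳ Ls m)) eL'
          bodyK = NotFalseLits-body θ' σ θr K onBody ps

      -- Resolving the selected atom with the rule instance used at the root of its derivation yields a child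
      -- whose literals are not false, with total derivation size smaller by one.
      resolvent-not-false : ∀ θ Ls Ls' C (p : RPred) (ts us : Vec Term (rarity p)) C₀ K θr σ → Injective _≡_ _≡_ σ →
        Sat θr C₀ → gV θ ts ≡ gV θr us →
        (∀ x → x ∈ fvRule (renRule σ (rule (p , us) C₀ K)) → x ∉ fvF C ++ fvLits (Ls ++ pos (p , ts) ∷ Ls')) →
        Sat θ C → (eL : NotFalseLits θ Ls) → (eL' : NotFalseLits θ Ls') → (ps : All NotFalseNext (map (gL θr) K)) →
        ∀ G'' → Derives Ls Ls' C (p , ts) (renRule σ (rule (p , us) C₀ K)) G'' →
        Σ (Var → GTerm) (λ θ'' → Sat θ'' (gcon G'') ×
          Σ (NotFalseLits θ'' (lits G'')) (λ e → sizeAll (gL θ'') e ≡ sizeAll (gL θ) eL + (sizeAll id ps + sizeAll (gL θ) eL')) ×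
          (∀ x → x ∉ fvRule (renRule σ (rule (p , us) C₀ K)) → θ'' x ≡ θ x))
      resolvent-not-false θ Ls Ls' C p ts us C₀ K θr σ inj satC₀ gts apart satC eL eL' ps ._ der =
          θ'' , satG , notFalse , offRule
        where
          r = rule (p , us) C₀ K
          v = variant-valuation σ inj r θr θ
          θ'' = proj₁ v
          onRule = proj₁ (proj₂ v)
          offRule = proj₂ (proj₂ v)
          onGoal : ∀ x → x ∈ fvF C ++ fvLits (Ls ++ pos (p , ts) ∷ Ls') → θ'' x ≡ θ x
          onGoal x m = offRule x (λ m' → apart x m' m)
          onLit : ∀ L x → L ∈ Ls ++ pos (p , ts) ∷ Ls' → x ∈ fvL L → θ'' x ≡ θ x
          onLit L x mL mx = onGoal x (∈-++⁺ʳ (fvF C) (fvL⊆fvLits L _ x mL mx))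
          gts'' : gV θ'' ts ≡ gV θ'' (renV σ us)
          gts'' = trans (gV-agree θ'' θ ts (λ x mx → onLit (pos (p , ts)) x (∈-++⁺ʳ Ls (here refl)) mx))
                   (trans gts (trans (gV-agree θr (θ'' ∘ σ) us (λ x mx → sym (onRule x (∈-++⁺ˡ mx))))
                                     (sym (gV-renV θ'' σ us))))
          satC'' : Sat θ'' C
          satC'' = ⟦⟧-agree M0 C (evg ∘ θ) (evg ∘ θ'') (λ x mx → cong evg (sym (onGoal x (∈-++⁺ˡ mx)))) satC
          satC₀'' : Sat θ'' (renF σ C₀)
          satC₀'' = proj₂ (⟦⟧-renF M0 σ inj C₀ (evg ∘ θ''))
                      (⟦⟧-agree M0 C₀ (evg ∘ θr) (evg ∘ (θ'' ∘ σ))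
                        (λ x mx → cong evg (sym (onRule x (∈-++⁺ʳ (fvV us) (∈-++⁺ˡ mx))))) satC₀)
          satG : Sat θ'' (eqsF ts (renV σ us) (C ∧f renF σ C₀))
          satG = ⟦eqsF⟧⁺ M0 ts (renV σ us) _ (evg ∘ θ'')
                   (trans (evV-gV θ'' ts) (trans (cong evgV gts'') (sym (evV-gV θ'' (renV σ us))))) (satC'' , satC₀'')
          notFalse = NotFalseLits-resolvent θ θ'' σ θr Ls Ls' K
                       (λ L mL → gL-agree θ θ'' L (λ x mx → sym (onLit L x (skip-selected mL) mx)))
                       (λ L mL → trans (gL-agree θr (θ'' ∘ σ) L
                          (λ x mx → sym (onRule x (∈-++⁺ʳ (fvV us) (∈-++⁺ʳ (fvF C₀) (fvL⊆fvLits L K x mL mx))))))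
                          (sym (gL-renL θ'' σ L)))
                       eL eL' ps
            where
              skip-selected : ∀ {L} → L ∈ Ls ++ Ls' → L ∈ Ls ++ pos (p , ts) ∷ Ls'
              skip-selected m = [ ∈-++⁺ˡ , (λ m' → ∈-++⁺ʳ Ls (there m')) ]′ (∈-++⁻ Ls m)

      TUConditions : Tree → List Goal → Set₁
      TUConditions s pre = ∀ (m : Node s) → NodeCond (TUSel SoundAnswer) (subAt m) (pre ++ pathGoals m)

      TUConditions-child : ∀ s pre c → TUConditions s pre → TUConditions (child s c) (pre ++ label s ∷ [])
      TUConditions-child s pre c cond m =
        subst (NodeCond (TUSel SoundAnswer) (subAt m)) (sym (++-assoc pre (label s ∷ []) (pathGoals m))) (cond (there c m))

      -- pre lists the goals above s
      SuccessfulBelow : Tree → List Goal → (Var → GTerm) → Set₁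
      SuccessfulBelow s pre θ = Σ (Node s) (λ n → Successful (labelAt n) × Σ (Var → GTerm) (λ θn →
          All (λ g → Sat θn (gcon g)) (pre ++ pathGoals n) × All (λ g → GAgree θn θ (fvGoal g)) (pre ++ label s ∷ [])))

      All-GAgree-trans : ∀ {θ₁ θ₂ θ₃} gs → All (λ g → GAgree θ₁ θ₂ (fvGoal g)) gs → All (λ g → GAgree θ₂ θ₃ (fvGoal g)) gs →
                         All (λ g → GAgree θ₁ θ₃ (fvGoal g)) gs
      All-GAgree-trans [] [] [] = []
      All-GAgree-trans (g ∷ gs) (a ∷ as) (b ∷ bs) = (λ x m → trans (a x m) (b x m)) ∷ All-GAgree-trans gs as bs

      NotFalseLits-subst : ∀ θ {g g'} (e : g ≡ g') (x : NotFalseLits θ (lits g)) →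
                           Σ (NotFalseLits θ (lits g')) (λ y → sizeAll (gL θ) y ≡ sizeAll (gL θ) x)
      NotFalseLits-subst θ refl x = x , refl

      NotFalseLits-split : ∀ θ (lsS : List Lit) Ls L Ls' → lsS ≡ Ls ++ L ∷ Ls' → (ev : NotFalseLits θ lsS) →
        Σ (NotFalseLits θ Ls) (λ eL → Σ (NotFalseNext (gL θ L)) (λ eA → Σ (NotFalseLits θ Ls') (λ eL' →
          sizeAll (gL θ) ev ≡ sizeAll (gL θ) eL + (size (gL θ L) eA + sizeAll (gL θ) eL'))))
      NotFalseLits-split θ .(Ls ++ L ∷ Ls') Ls L Ls' refl ev with All.++⁻ Ls ev | sizeAll-++⁻ (gL θ) Ls ev
      ... | eL , (eA ∷ eL') | sz = eL , eA , eL' , sz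

      <-step : ∀ a b c f → a + (suc b + c) < suc f → a + (b + c) < f
      <-step a b c f (s≤s h) = ≤-trans (+-monoʳ-< a (n<1+n (b + c))) h

      -- By recursion on the total size of the derivations witnessing that the literals are not false: resolving
      -- an atom replaces its derivation by the derivations of the body, and a negative step drops a literal.
      descend : ∀ (fuel : ℕ) s pre → TUConditions s pre → ∀ θ → (ev : NotFalseLits θ (lits (label s))) →
                sizeAll (gL θ) ev < fuel → All (λ g → Sat θ (gcon g)) (pre ++ label s ∷ []) → SuccessfulBelow s pre θ

      descend-child : ∀ fuel s pre → TUConditions s pre → ∀ θ (c : Child s) θc
                      (evc : NotFalseLits θc (lits (label (child s c)))) → sizeAll (gL θc) evc < fuel →
                      All (λ g → Sat θc (gcon g)) ((pre ++ label s ∷ []) ++ label (child s c) ∷ []) →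
                      All (λ g → GAgree θc θ (fvGoal g)) (pre ++ label s ∷ []) → SuccessfulBelow s pre θ
      descend-child fuel s pre cond θ c θc evc lt sat agree
        with descend fuel (child s c) (pre ++ label s ∷ []) (TUConditions-child s pre c cond) θc evc lt sat
      ... | n , succ , θn , satn , agreen = there c n , succ , θn ,
              subst (All (λ g → Sat θn (gcon g))) (++-assoc pre (label s ∷ []) (pathGoals n)) satn ,
              All-GAgree-trans (pre ++ label s ∷ []) (proj₁ (All.++⁻ (pre ++ label s ∷ []) agreen)) agree

      descend-expansion : ∀ fuel s pre → TUConditions s pre → ∀ θ → All (λ g → Sat θ (gcon g)) (pre ++ label s ∷ []) →
        ∀ Ls Ls' (p : RPred) (ts us : Vec Term (rarity p)) C₀ K θr → Sat θr C₀ → gV θ ts ≡ gV θr us →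
        lits (label s) ≡ Ls ++ pos (p , ts) ∷ Ls' →
        (eL : NotFalseLits θ Ls) (ps : All NotFalseNext (map (gL θr) K)) (eL' : NotFalseLits θ Ls') →
        sizeAll (gL θ) eL + (suc (sizeAll id ps) + sizeAll (gL θ) eL') < suc fuel → ∀ c →
        Expands (pre ++ label s ∷ []) Ls Ls' (gcon (label s)) (p , ts) (rule (p , us) C₀ K) (label (child s c)) →
        SuccessfulBelow s pre θ
      descend-expansion fuel s pre cond θ sat Ls Ls' p ts us C₀ K θr satC₀ gts eq eL ps eL' lt c
                        (_ , (σ , inj , refl) , fresh , derived , _) =
        descend-child fuel s pre cond θ c θ'' (proj₁ (proj₁ (proj₂ (proj₂ res))))
          (subst (_< fuel) (sym (proj₂ (proj₁ (proj₂ (proj₂ res)))))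
            (<-step (sizeAll (gL θ) eL) (sizeAll id ps) (sizeAll (gL θ) eL') fuel lt))
          (All.++⁺ satAbove (proj₁ (proj₂ res) ∷ [])) (All.tabulate (λ {g} g∈ x x∈ → offAbove g g∈ x x∈))
        where
          gs = pre ++ label s ∷ []
          res = resolvent-not-false θ Ls Ls' (gcon (label s)) p ts us C₀ K θr σ inj satC₀ gts
                  (fresh-apart pre s eq (renRule σ (rule (p , us) C₀ K)) fresh)
                  (All.lookup sat (∈-++⁺ʳ pre (here refl))) eL eL' ps (label (child s c)) derived
          θ'' = proj₁ res
          offAbove : ∀ g → g ∈ gs → ∀ x → x ∈ fvGoal g → θ'' x ≡ θ x
          offAbove g g∈ x x∈ = proj₂ (proj₂ (proj₂ res)) x (λ m → All.lookup (fresh x m) g∈ x∈)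
          satAbove : All (λ g → Sat θ'' (gcon g)) gs
          satAbove = All.tabulate (λ {g} g∈ → ⟦⟧-agree M0 (gcon g) (evg ∘ θ) (evg ∘ θ'')
                       (λ x x∈ → cong evg (sym (offAbove g g∈ x (∈-++⁺ˡ x∈)))) (All.lookup sat g∈))

      descend-pos : ∀ fuel s pre → TUConditions s pre → ∀ θ → All (λ g → Sat θ (gcon g)) (pre ++ label s ∷ []) →
        ∀ Ls Ls' (p : RPred) (ts : Vec Term (rarity p)) → lits (label s) ≡ Ls ++ pos (p , ts) ∷ Ls' →
        PosStep (pre ++ label s ∷ []) Ls Ls' (gcon (label s)) (p , ts) s →
        (eL : NotFalseLits θ Ls) (eA : LM Q NotTrueAt (p , gV θ ts)) (eL' : NotFalseLits θ Ls') →
        sizeAll (gL θ) eL + (derivationSize eA + sizeAll (gL θ) eL') < suc fuel → SuccessfulBelow s pre θ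
      descend-pos fuel s pre cond θ sat Ls Ls' p ts eq (ro , Pro , _ , exps , complete) eL
                  (derive (rule (q , us) C₀ K , Pr , θr , satr , geq) ps) eL' lt
        with Σ-≡,≡←≡ (cong GRule.ghead geq) | cong GRule.gbody geq
      ... | refl , gts | refl =
        descend-expansion fuel s pre cond θ sat Ls Ls' p ts us C₀ K θr satC₀ gts eq eL ps eL' lt c
          (subst (λ r → Expands gs Ls Ls' C (p , ts) r (label (child s c))) (proj₂ selected) (exps c))
        where
          gs = pre ++ label s ∷ []
          C = gcon (label s)
          r = rule (p , us) C₀ K
          satC₀ : Sat θr C₀
          satC₀ = ⊨[]→Sat θr C₀ satr
          -- A fresh variant of r gives a satisfiable resolvent, so the tree has a child for r.
          variant₀ = fresh-variant gs r
          σ₀ = proj₁ variant₀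
          G₀ = goal (eqsF ts (renV σ₀ us) (C ∧f renF σ₀ C₀)) (Ls ++ map (renL σ₀) K ++ Ls')
          res₀ = resolvent-not-false θ Ls Ls' C p ts us C₀ K θr σ₀ (proj₁ (proj₂ variant₀)) satC₀ gts
                   (fresh-apart pre s eq (renRule σ₀ r) (proj₂ (proj₂ variant₀)))
                   (All.lookup sat (∈-++⁺ʳ pre (here refl))) eL eL' ps G₀ der
          exp₀ : Expands gs Ls Ls' C (p , ts) r G₀
          exp₀ = renRule σ₀ r , (σ₀ , proj₁ (proj₂ variant₀) , refl) , proj₂ (proj₂ variant₀) , der ,
                 (M0 , mod , evg ∘ proj₁ res₀ , proj₁ (proj₂ res₀))
          selected = complete r Pr (G₀ , exp₀)
          c = proj₁ selected

      descend-neg : ∀ fuel s pre → TUConditions s pre → ∀ θ → All (λ g → Sat θ (gcon g)) (pre ++ label s ∷ []) →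
        ∀ Ls Ls' A → TUSel SoundAnswer (pre ++ label s ∷ []) Ls (neg A) Ls' (gcon (label s)) s →
        (eL : NotFalseLits θ Ls) (eA : NotTrueAt (gA θ A)) (eL' : NotFalseLits θ Ls') →
        sizeAll (gL θ) eL + (1 + sizeAll (gL θ) eL') < suc fuel → SuccessfulBelow s pre θ
      descend-neg fuel s pre cond θ sat Ls Ls' A sel eL eA eL' lt = viaChild sel
        where
          satC : Sat θ (gcon (label s))
          satC = All.lookup sat (∈-++⁺ʳ pre (here refl))
          lt' : sizeAll (gL θ) (All.++⁺ eL eL') < fuel
          lt' = subst (_< fuel) (sym (sizeAll-++⁺ (gL θ) eL eL')) (<-step (sizeAll (gL θ) eL) 0 (sizeAll (gL θ) eL') fuel lt)
          answer-fails : ∀ C'' → SoundAnswer (goal (gcon (label s)) (pos A ∷ [])) C'' → ¬ Sat θ C''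
          answer-fails C'' (lift sound) h = eA (All.lookup (proj₂ (sound θ h)) (here refl))
          continue : ∀ c {C'} → label (child s c) ≡ goal C' (Ls ++ Ls') → Sat θ C' → SuccessfulBelow s pre θ
          continue c eql satC' with NotFalseLits-subst θ (sym eql) (All.++⁺ eL eL')
          ... | evc , sz = descend-child fuel s pre cond θ c θ evc (subst (_< fuel) (sym sz) lt')
                             (All.++⁺ sat (subst (λ g → Sat θ (gcon g)) (sym eql) satC' ∷ []))
                             (All.tabulate (λ _ _ _ → refl))
          viaChild : TUSel SoundAnswer (pre ++ label s ∷ []) Ls (neg A) Ls' (gcon (label s)) s → SuccessfulBelow s pre θ
          viaChild (inj₁ ((c , _) , eql)) = continue c eql satC
          viaChild (inj₂ (inj₁ ((c , _) , C'' , ans , _ , eql))) = continue c eql (answer-fails C'' ans , satC)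
          viaChild (inj₂ (inj₂ (_ , C'' , ans , unsat))) = ⊥-elim (unsat (M0 , mod , evg ∘ θ , (answer-fails C'' ans , satC)))

      descend zero s pre cond θ ev () sat
      descend (suc fuel) s pre cond θ ev lt sat with cond here
      ... | inj₁ (succ , _) = here , succ , θ , sat , All.tabulate (λ _ _ _ → refl)
      ... | inj₂ (Ls , L , Ls' , eq , sel) with NotFalseLits-split θ (lits (label s)) Ls L Ls' eq ev
      ...   | eL , eA , eL' , sz = descend-at L eq sel eA (subst (_< suc fuel) sz lt)
        where
          descend-at : ∀ L → lits (label s) ≡ Ls ++ L ∷ Ls' → TUSel SoundAnswer (pre ++ label s ∷ []) Ls L Ls' (gcon (label s)) s →
                       (eA : NotFalseNext (gL θ L)) → sizeAll (gL θ) eL + (size (gL θ L) eA + sizeAll (gL θ) eL') < suc fuel →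
                       SuccessfulBelow s pre θ
          descend-at (pos (p , ts)) eq sel eA = descend-pos fuel s pre cond θ sat Ls Ls' p ts eq sel eL eA eL'
          descend-at (neg A) _ sel eA = descend-neg fuel s pre cond θ sat Ls Ls' A sel eL eA eL'

      NotFalseLits-classical : ∀ θ Ls → ¬ Any (λ L → Ψ↑ Q (os k) (compl (gL θ L))) Ls → NotFalseLits θ Ls
      NotFalseLits-classical θ Ls noneFalse = All.tabulate (λ {L} m → notFalse L (λ p → noneFalse (lose m p)))
        where
          notFalse : ∀ L → ¬ Ψ↑ Q (os k) (compl (gL θ L)) → NotFalseNext (gL θ L)
          notFalse (pos A) h with em {LM Q NotTrueAt (gA θ A)}
          ... | yes p = p
          ... | no ¬p = ⊥-elim (h ¬p)
          notFalse (neg A) h = λ p → h (Ψ↑-⊆-suc Q k (gpos (gA θ A)) p)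

      negAnswer-sound : ∀ t → TUConditions t [] → ∀ C → NegAnswer t C → ∀ θ → M0 ⊨ (C [ θ ]F) →
                        HoldsNeg3 M0 (Ψ↑ Q (os k)) (label t) θ
      negAnswer-sound t cond C na θ hC with em {M0 ⊨ (gcon (label t) [ θ ]F)}
      ... | no unsat = inj₁ unsat
      ... | yes satRoot with em {Any (λ L → Ψ↑ Q (os k) (compl (gL θ L))) (lits (label t))}
      ...   | yes someFalse = inj₂ someFalse
      ...   | no noneFalse = ⊥-elim (refuted (descend (suc (sizeAll (gL θ) notFalse)) t [] cond θ notFalse (n<1+n _)
                                                 (⊨[]→Sat θ (gcon (label t)) satRoot ∷ [])))
        where
          notFalse = NotFalseLits-classical θ (lits (label t)) noneFalse
          refuted : SuccessfulBelow t [] θ → ⊥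
          refuted (n , succ , θn , satPath , agree ∷ []) with proj₁ (proj₂ na) n succ
          ... | m , m≼n , m∈Sn = negAnswer-refutes t C na θ (⊨[]→Sat θ C hC) m m∈Sn
                                   (∃₋-intro (label t) (gcon (labelAt m)) θ θn (All.lookup satPath (≼⇒∈pathGoals m≼n)) agree)

    NegAnswerBelow : Ord → Goal → Form → Set₁
    NegAnswerBelow k G C = Σ Ord (λ j → j <o k × Σ Tree (λ t' → TUTree j t' × label t' ≡ G × NegAnswer t' C))

    AnswerBelow : Ord → Goal → Form → Set₁
    AnswerBelow k G C = Σ Ord (λ j → j <o k × Σ Tree (λ t' → TTree j t' × label t' ≡ G × Answer t' C))

    -- What each of the three alternative hypotheses of the theorem provides: an invariant of the constraints
    -- in the trees under which successful leaves can be grounded.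
    record Groundable : Set₂ where
      field
        Inv : Form → Set₁
        inv-constraint : ∀ F → IsC F → Inv F
        inv-TTree : ∀ {k t} → TTree k t → Inv (gcon (label t)) → ∀ (n : Node t) → Inv (gcon (labelAt n))
        inv-TUTree : ∀ {k t} → TUTree k t → Inv (gcon (label t)) → ∀ (n : Node t) → Inv (gcon (labelAt n))
        groundable-leaves : ∀ {k t} → TTree k t → Inv (gcon (label t)) → GroundableLeaves t

    module ByRank (grd : Groundable) where
      open Groundable grd

      tTree-sound : ∀ k t → TTree k t → Inv (gcon (label t)) → ∀ C → Answer t C → ∀ θ → M0 ⊨ (C [ θ ]F) →
                    Holds3 M0 (Ψ↑ Q (os k)) (label t) θ
      tuTree-sound : ∀ k t → TUTree k t → Inv (gcon (label t)) → ∀ C → NegAnswer t C → ∀ θ → M0 ⊨ (C [ θ ]F) →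
                     HoldsNeg3 M0 (Ψ↑ Q (os k)) (label t) θ
      sound-TSel : ∀ k {s gs} → Inv (gcon (label s)) →
                   NodeCond (TSel (NegAnswerBelow k)) s gs → NodeCond (TSel (Answers.SoundNegAnswer k)) s gs
      sound-TUSel : ∀ k {s gs} → Inv (gcon (label s)) →
                    NodeCond (TUSel (AnswerBelow k)) s gs → NodeCond (TUSel (NegAnswers.SoundAnswer k)) s gs

      negAnswer-sound-below : ∀ {k j G} → j <o k → ∀ t' → TUTree j t' → label t' ≡ G → Inv (gcon G) →
                              ∀ C → NegAnswer t' C → Answers.SoundNegAnswer k G C
      answer-sound-below : ∀ {k j G} → j <o k → ∀ t' → TTree j t' → label t' ≡ G → Inv (gcon G) →
                           ∀ C → Answer t' C → NegAnswers.SoundAnswer k G C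

      tTree-sound k t (ttree f) inv =
        Answers.answer-sound k t (λ m → sound-TSel k (inv-TTree (ttree f) inv m) (f m)) (groundable-leaves (ttree f) inv)
      tuTree-sound k t (tutree f) inv =
        NegAnswers.negAnswer-sound k t (λ m → sound-TUSel k (inv-TUTree (tutree f) inv m) (f m))

      sound-TSel k inv (inj₁ leaf) = inj₁ leaf
      sound-TSel k inv (inj₂ (Ls , pos A , Ls' , eq , step)) = inj₂ (Ls , pos A , Ls' , eq , step)
      sound-TSel k inv (inj₂ (Ls , neg A , Ls' , eq , inj₁ leaf)) = inj₂ (Ls , neg A , Ls' , eq , inj₁ leaf)
      sound-TSel k {s} inv (inj₂ (Ls , neg A , Ls' , eq , inj₂ (sg , C' , (j , j<k , t' , tu , t'≡ , na) , sat , eql))) =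
        inj₂ (Ls , neg A , Ls' , eq , inj₂ (sg , C' , negAnswer-sound-below j<k t' tu t'≡ inv C' na , sat , eql))

      sound-TUSel k inv (inj₁ leaf) = inj₁ leaf
      sound-TUSel k inv (inj₂ (Ls , pos A , Ls' , eq , step)) = inj₂ (Ls , pos A , Ls' , eq , step)
      sound-TUSel k inv (inj₂ (Ls , neg A , Ls' , eq , inj₁ drop)) = inj₂ (Ls , neg A , Ls' , eq , inj₁ drop)
      sound-TUSel k {s} inv (inj₂ (Ls , neg A , Ls' , eq , inj₂ (inj₁ (sg , C'' , (j , j<k , t' , tree , t'≡ , ans) , sat , eql)))) =
        inj₂ (Ls , neg A , Ls' , eq , inj₂ (inj₁ (sg , C'' , answer-sound-below j<k t' tree t'≡ inv C'' ans , sat , eql)))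
      sound-TUSel k {s} inv (inj₂ (Ls , neg A , Ls' , eq , inj₂ (inj₂ (leaf , C'' , (j , j<k , t' , tree , t'≡ , ans) , unsat)))) =
        inj₂ (Ls , neg A , Ls' , eq , inj₂ (inj₂ (leaf , C'' , answer-sound-below j<k t' tree t'≡ inv C'' ans , unsat)))

      negAnswer-sound-below {k} j<k t' tu refl inv C na = lift (λ θ h →
        HoldsNeg3-mono (Ψ↑-mono Q j<k) (label t') θ (tuTree-sound _ t' tu inv C na θ (Sat→⊨[] θ C h)))
      answer-sound-below {k} j<k t' tree refl inv C ans = lift (λ θ h →
        Holds3-mono (Ψ↑-mono Q j<k) (label t') θ (tTree-sound _ t' tree inv C ans θ (Sat→⊨[] θ C h)))

module HerbrandGrounding (em : ExcludedMiddle 0ℓ) (S : Sig) where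
  open Hybrid S
  open FormulaSemantics S
  open GroundSyntax S
  open Soundness em S

  module _ (T : Theory) (IsC : Form → Set) (SA : StandingAssumptions T IsC) (P : Rule → Set)
           (M0 : Structure) (mod : Model T M0) (herbrand : Herbrand M0) where
    open Ground M0
    open Program T IsC SA P M0 mod

    private
      to = Inverse.to (proj₁ herbrand)
      from = Inverse.from (proj₁ herbrand)

    to-evg : ∀ g → to (evg g) ≡ g
    to-evgV : ∀ {n} (gs : Vec GTerm n) → vmap to (evgV gs) ≡ gs
    to-evg (gfn f gs) = trans (proj₂ herbrand f (evgV gs)) (cong (gfn f) (to-evgV gs))
    to-evgV [] = refl
    to-evgV (g ∷ gs) = cong₂ _∷_ (to-evg g) (to-evgV gs)

    evg-to : ∀ d → evg (to d) ≡ d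
    evg-to d = trans (sym (Inverse.strictlyInverseʳ (proj₁ herbrand) (evg (to d))))
                 (trans (cong from (to-evg (to d))) (Inverse.strictlyInverseʳ (proj₁ herbrand) d))

    groundable : Groundable
    groundable = record
      { Inv = λ _ → Lift (lsuc 0ℓ) ⊤
      ; inv-constraint = λ _ _ → lift tt
      ; inv-TTree = λ _ _ _ → lift tt
      ; inv-TUTree = λ _ _ _ → lift tt
      ; groundable-leaves = λ _ _ n _ ρ θ satn agree →
          to ∘ ρ , ⟦⟧-≗ M0 (gcon (labelAt n)) ρ (evg ∘ (to ∘ ρ)) (λ x → sym (evg-to (ρ x))) satn ,
          (λ x m → trans (cong to (agree x m)) (to-evg (θ x)))
      }

module WitnessGrounding (em : ExcludedMiddle 0ℓ) (S : Sig) where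
  open Hybrid S
  open FormulaSemantics S
  open GroundSyntax S
  open FreeTermAlgebra em S
  open Soundness em S
  open Equivalence using (to; from)

  module _ (T : Theory) (IsC : Form → Set) (SA : StandingAssumptions T IsC) (P : Rule → Set)
           (rule-constraints : ∀ r → P r → IsC (con r)) (M0 : Structure) (mod : Model T M0)
           (witnesses : WitnessProperty T IsC) where
    open Trees T IsC P
    open Structure M0
    open Ground M0
    open ModelOfCET T IsC SA M0 mod
    open Program T IsC SA P M0 mod
    open StandingAssumptions SA

    EquivConstraint : Form → Set
    EquivConstraint F = Σ Form (λ F' → IsC F' × (∀ ρ → ⟦_⟧ M0 F ρ ⇔ ⟦_⟧ M0 F' ρ))

    constraint-equiv : ∀ F → IsC F → EquivConstraint F
    constraint-equiv F isC = F , isC , λ ρ → mk⇔ id id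

    isC-⊤f : IsC ⊤f
    isC-⊤f = eqC cstT cstT

    isC-conj : ∀ cs → All IsC cs → IsC (conj cs)
    isC-conj [] [] = isC-⊤f
    isC-conj (c ∷ []) (i ∷ []) = i
    isC-conj (c ∷ cs@(_ ∷ _)) (i ∷ is) = ∧C c (conj cs) i (isC-conj cs is)

    isC-exClose : ∀ xs F → IsC F → IsC (exClose xs F)
    isC-exClose [] F i = i
    isC-exClose (x ∷ xs) F i = ∃C x (exClose xs F) (isC-exClose xs F i)

    equiv-∧ : ∀ F G → EquivConstraint F → EquivConstraint G → EquivConstraint (F ∧f G)
    equiv-∧ F G (F' , i , e) (G' , j , e') = F' ∧f G' , ∧C F' G' i j , λ ρ → mk⇔
      (λ { (a , b) → to (e ρ) a , to (e' ρ) b }) (λ { (a , b) → from (e ρ) a , from (e' ρ) b })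

    equiv-∨ : ∀ F G → EquivConstraint F → EquivConstraint G → EquivConstraint (F ∨f G)
    equiv-∨ F G (F' , i , e) (G' , j , e') = F' ∨f G' , ∨C F' G' i j , λ ρ → mk⇔
      (λ { (inj₁ a) → inj₁ (to (e ρ) a) ; (inj₂ b) → inj₂ (to (e' ρ) b) })
      (λ { (inj₁ a) → inj₁ (from (e ρ) a) ; (inj₂ b) → inj₂ (from (e' ρ) b) })

    equiv-¬ : ∀ F → EquivConstraint F → EquivConstraint (¬f F)
    equiv-¬ F (F' , i , e) = ¬f F' , ¬C F' i , λ ρ → mk⇔ (λ h a → h (from (e ρ) a)) (λ h a → h (to (e ρ) a))

    equiv-exClose : ∀ xs F → EquivConstraint F → EquivConstraint (exClose xs F)
    equiv-exClose [] F e = e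
    equiv-exClose (x ∷ xs) F e with equiv-exClose xs F e
    ... | F' , i , e' = ∃f x F' , ∃C x F' i , λ ρ → mk⇔
      (λ { (d , a) → d , to (e' _) a }) (λ { (d , a) → d , from (e' _) a })

    equiv-∃₋ : ∀ G F → EquivConstraint F → EquivConstraint (∃₋ G F)
    equiv-∃₋ G F = equiv-exClose (filter (λ x → ¬? (x ∈? fvGoal G)) (deduplicate _≟_ (fvF F))) F

    equiv-conj : ∀ cs → All EquivConstraint cs → EquivConstraint (conj cs)
    equiv-conj [] [] = constraint-equiv ⊤f isC-⊤f
    equiv-conj (c ∷ []) (e ∷ []) = e
    equiv-conj (c ∷ cs@(_ ∷ _)) (e ∷ es) = equiv-∧ c (conj cs) e (equiv-conj cs es)

    equiv-disj : ∀ cs → All EquivConstraint cs → EquivConstraint (disj cs)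
    equiv-disj [] [] = constraint-equiv ⊥f (¬C ⊤f isC-⊤f)
    equiv-disj (c ∷ []) (e ∷ []) = e
    equiv-disj (c ∷ cs@(_ ∷ _)) (e ∷ es) = equiv-∨ c (disj cs) e (equiv-disj cs es)

    equiv-eqsF : ∀ {n} (ts us : Vec Term n) C → EquivConstraint C → EquivConstraint (eqsF ts us C)
    equiv-eqsF [] [] C e = e
    equiv-eqsF (t ∷ ts) (u ∷ us) C e = equiv-∧ (t ≐ u) (eqsF ts us C) (constraint-equiv _ (eqC t u)) (equiv-eqsF ts us C e)

    overrideEnv : Env M0 → List Var → Env M0 → Env M0
    overrideEnv ρ ys g y with y ∈? ys
    ... | yes _ = g y
    ... | no _ = ρ y

    overrideEnv-∈ : ∀ ρ ys g y → y ∈ ys → overrideEnv ρ ys g y ≡ g y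
    overrideEnv-∈ ρ ys g y m with y ∈? ys
    ... | yes _ = refl
    ... | no y∉ = ⊥-elim (y∉ m)

    overrideEnv-∉ : ∀ ρ ys g y → y ∉ ys → overrideEnv ρ ys g y ≡ ρ y
    overrideEnv-∉ ρ ys g y y∉ with y ∈? ys
    ... | yes m = ⊥-elim (y∉ m)
    ... | no _ = refl

    equations : List Var → (Var → Var) → Form
    equations ys t = conj (map (λ y → var y ≐ var (t y)) ys)

    isC-equations : ∀ ys t → IsC (equations ys t)
    isC-equations ys t = isC-conj _ (All.map⁺ {f = λ y → var y ≐ var (t y)} (All.tabulate {xs = ys} (λ _ → eqC _ _)))

    ⟦equations⟧⁻ : ∀ ys t ρ → ⟦_⟧ M0 (equations ys t) ρ → ∀ y → y ∈ ys → ρ y ≡ ρ (t y)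
    ⟦equations⟧⁻ ys t ρ h y = All.lookup (All.map⁻ {f = λ y → var y ≐ var (t y)} (⟦conj⟧⁻ M0 _ ρ h))

    ⟦equations⟧⁺ : ∀ ys t ρ → (∀ y → y ∈ ys → ρ y ≡ ρ (t y)) → ⟦_⟧ M0 (equations ys t) ρ
    ⟦equations⟧⁺ ys t ρ h = ⟦conj⟧⁺ M0 _ ρ (All.map⁺ {f = λ y → var y ≐ var (t y)} (All.tabulate {xs = ys} (λ {y} → h y)))

    ⟦∃equations⟧ : ∀ ys t H → (∀ y → y ∈ ys → t y ∉ ys) → ∀ ρ →
                   ⟦_⟧ M0 (exClose ys (equations ys t ∧f H)) ρ ⇔ ⟦_⟧ M0 H (overrideEnv ρ ys (ρ ∘ t))
    ⟦∃equations⟧ ys t H t-out ρ = mk⇔ elim intro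
      where
        elim : ⟦_⟧ M0 (exClose ys (equations ys t ∧f H)) ρ → ⟦_⟧ M0 H (overrideEnv ρ ys (ρ ∘ t))
        elim h with exClose-elim M0 ys (equations ys t ∧f H) ρ h
        ... | ρ' , (eqs , hH) , off = ⟦⟧-≗ M0 H ρ' _ same hH
          where
            same : ∀ y → ρ' y ≡ overrideEnv ρ ys (ρ ∘ t) y
            same y with y ∈? ys
            ... | yes m = trans (⟦equations⟧⁻ ys t ρ' eqs y m) (off (t y) (t-out y m))
            ... | no y∉ = off y y∉
        intro : ⟦_⟧ M0 H (overrideEnv ρ ys (ρ ∘ t)) → ⟦_⟧ M0 (exClose ys (equations ys t ∧f H)) ρ
        intro h = exClose-intro M0 ys _ ρ (overrideEnv ρ ys (ρ ∘ t)) (λ y y∉ _ → overrideEnv-∉ ρ ys _ y y∉)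
                    (⟦equations⟧⁺ ys t _ (λ y m → trans (overrideEnv-∈ ρ ys _ y m)
                                                  (sym (overrideEnv-∉ ρ ys _ (t y) (t-out y m)))) , h)

    -- F σ is expressed as ∃ȳ (ȳ = σ (ȳ - N) ∧ ∃x̄ (x̄ = N + x̄ ∧ F)) with x̄ the free variables of F and ȳ = N + x̄;
    -- going through the fresh block N + x̄ keeps the two blocks of equations from clashing.
    equiv-renF : ∀ σ → Injective _≡_ _≡_ σ → ∀ F → IsC F → EquivConstraint (renF σ F)
    equiv-renF σ inj F i = H₂ , isH₂ , equiv
      where
        xs = fvF F
        N = suc (maxV (xs ++ map σ xs))
        ys = map (N +_) xs
        back : Var → Var
        back y = σ (y ∸ N)
        H₁ = exClose xs (equations xs (N +_) ∧f F)
        H₂ = exClose ys (equations ys back ∧f H₁)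
        isH₂ : IsC H₂
        isH₂ = isC-exClose ys _ (∧C _ _ (isC-equations ys back) (isC-exClose xs _ (∧C _ _ (isC-equations xs (N +_)) i)))
        below : ∀ v → v ∈ xs ++ map σ xs → v < N
        below v m = s≤s (maxV-≤ _ v m)
        shift-out : ∀ y → y ∈ xs → N + y ∉ xs
        shift-out y _ m = <-irrefl refl (≤-<-trans (m≤m+n N y) (below (N + y) (∈-++⁺ˡ m)))
        back-out : ∀ y → y ∈ ys → back y ∉ ys
        back-out y m m' with ∈-map⁻ (N +_) m | ∈-map⁻ (N +_) m'
        ... | x , mx , refl | x' , _ , e' =
          <-irrefl refl (≤-<-trans (subst (N ≤_) (sym e') (m≤m+n N x'))
            (below (σ (N + x ∸ N)) (∈-++⁺ʳ xs (subst (λ z → σ z ∈ map σ xs) (sym (m+n∸m≡n N x)) (∈-map⁺ σ mx)))))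
        equiv : ∀ ρ → ⟦_⟧ M0 (renF σ F) ρ ⇔ ⟦_⟧ M0 H₂ ρ
        equiv ρ = mk⇔
          (λ h → from (⟦∃equations⟧ ys back H₁ back-out ρ) (from (⟦∃equations⟧ xs (N +_) F shift-out ρ₁)
                   (⟦⟧-agree M0 F (ρ ∘ σ) _ (λ x m → sym (ρ₂≡ x m)) (proj₁ (⟦⟧-renF M0 σ inj F ρ) h))))
          (λ h → proj₂ (⟦⟧-renF M0 σ inj F ρ) (⟦⟧-agree M0 F _ (ρ ∘ σ) ρ₂≡
                   (to (⟦∃equations⟧ xs (N +_) F shift-out ρ₁) (to (⟦∃equations⟧ ys back H₁ back-out ρ) h))))
          where
            ρ₁ = overrideEnv ρ ys (ρ ∘ back)
            ρ₂≡ : ∀ x → x ∈ xs → overrideEnv ρ₁ xs (ρ₁ ∘ (N +_)) x ≡ ρ (σ x)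
            ρ₂≡ x m = trans (overrideEnv-∈ ρ₁ xs _ x m)
                        (trans (overrideEnv-∈ ρ ys _ (N + x) (∈-map⁺ (N +_) m)) (cong (ρ ∘ σ) (m+n∸m≡n N x)))

    PreservesEquiv : Goal → Form → Set₁
    PreservesEquiv G C = Lift (lsuc 0ℓ) (EquivConstraint (gcon G) → EquivConstraint C)

    equiv-expansion : ∀ gs Ls Ls' C A r G'' → P r → Expands gs Ls Ls' C A r G'' →
                      EquivConstraint C → EquivConstraint (gcon G'')
    equiv-expansion gs Ls Ls' C A (rule (p , us) C₀ K) G'' Pr (_ , (σ , inj , refl) , _ , der {ts = ts} , _) e =
      equiv-eqsF ts (renV σ us) (C ∧f renF σ C₀) (equiv-∧ C (renF σ C₀) e (equiv-renF σ inj C₀ (rule-constraints _ Pr)))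

    equiv-child-T : ∀ s gs → NodeCond (TSel PreservesEquiv) s gs → (c : Child s) →
                    EquivConstraint (gcon (label s)) → EquivConstraint (gcon (label (child s c)))
    equiv-child-T s gs (inj₁ (_ , noChild)) c e = ⊥-elim (noChild c)
    equiv-child-T s gs (inj₂ (Ls , pos A , Ls' , eq , (ro , Pro , _ , exps , _))) c e =
      equiv-expansion gs Ls Ls' (gcon (label s)) A (ro c) (label (child s c)) (Pro c) (exps c) e
    equiv-child-T s gs (inj₂ (Ls , neg A , Ls' , eq , inj₁ noChild)) c e = ⊥-elim (noChild c)
    equiv-child-T s gs (inj₂ (Ls , neg A , Ls' , eq , inj₂ ((c₀ , unique) , C' , lift f , _ , eql))) c e =
      subst (EquivConstraint ∘ gcon) (sym (trans (cong (λ c → label (child s c)) (unique c)) eql))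
        (equiv-∧ C' (gcon (label s)) (f e) e)

    equiv-child-TU : ∀ s gs → NodeCond (TUSel PreservesEquiv) s gs → (c : Child s) →
                     EquivConstraint (gcon (label s)) → EquivConstraint (gcon (label (child s c)))
    equiv-child-TU s gs (inj₁ (_ , noChild)) c e = ⊥-elim (noChild c)
    equiv-child-TU s gs (inj₂ (Ls , pos A , Ls' , eq , (ro , Pro , _ , exps , _))) c e =
      equiv-expansion gs Ls Ls' (gcon (label s)) A (ro c) (label (child s c)) (Pro c) (exps c) e
    equiv-child-TU s gs (inj₂ (Ls , neg A , Ls' , eq , inj₁ ((c₀ , unique) , eql))) c e =
      subst (EquivConstraint ∘ gcon) (sym (trans (cong (λ c → label (child s c)) (unique c)) eql)) e
    equiv-child-TU s gs (inj₂ (Ls , neg A , Ls' , eq , inj₂ (inj₁ ((c₀ , unique) , C'' , lift f , _ , eql)))) c e =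
      subst (EquivConstraint ∘ gcon) (sym (trans (cong (λ c → label (child s c)) (unique c)) eql))
        (equiv-∧ (¬f C'') (gcon (label s)) (equiv-¬ C'' (f e)) e)
    equiv-child-TU s gs (inj₂ (Ls , neg A , Ls' , eq , inj₂ (inj₂ (noChild , _)))) c e = ⊥-elim (noChild c)

    equiv-nodes : ∀ (Sel : List Goal → List Lit → Lit → List Lit → Form → Tree → Set₁) →
                  (∀ s gs → NodeCond Sel s gs → (c : Child s) →
                     EquivConstraint (gcon (label s)) → EquivConstraint (gcon (label (child s c)))) →
                  ∀ t → (∀ (m : Node t) → Σ (List Goal) (NodeCond Sel (subAt m))) →
                  EquivConstraint (gcon (label t)) → ∀ (n : Node t) → EquivConstraint (gcon (labelAt n))
    equiv-nodes Sel child-step t cond e here = e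
    equiv-nodes Sel child-step t cond e (there c n) =
      equiv-nodes Sel child-step (child t c) (λ m → cond (there c m)) (child-step t _ (proj₂ (cond here)) c e) n

    equiv-answer : ∀ t' → (∀ (n : Node t') → EquivConstraint (gcon (labelAt n))) → ∀ C → Answer t' C → EquivConstraint C
    equiv-answer t' e C (ns , _ , refl) = equiv-∃₋ (label t') (disj (map (gcon ∘ labelAt) ns))
      (equiv-disj (map (gcon ∘ labelAt) ns) (All.map⁺ {f = gcon ∘ labelAt} (All.tabulate {xs = ns} (λ {n} _ → e n))))

    equiv-negAnswer : ∀ t' → (∀ (n : Node t') → EquivConstraint (gcon (labelAt n))) → ∀ C → NegAnswer t' C →
                      EquivConstraint C
    equiv-negAnswer t' e C (_ , _ , inj₁ (cs , enum , refl)) =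
      equiv-conj (map (λ Ci → ¬f ∃₋ (label t') Ci) cs) (All.map⁺ {f = λ Ci → ¬f ∃₋ (label t') Ci} (All.tabulate {xs = cs} neg∃))
      where
        neg∃ : ∀ {Ci} → Ci ∈ cs → EquivConstraint (¬f ∃₋ (label t') Ci)
        neg∃ {Ci} m with proj₁ (enum Ci) m
        ... | n , _ , refl = equiv-¬ (∃₋ (label t') (gcon (labelAt n))) (equiv-∃₋ (label t') (gcon (labelAt n)) (e n))
    equiv-negAnswer t' e C (_ , _ , inj₂ (_ , isC , _ , _)) = constraint-equiv C isC

    equiv-TTree : ∀ {k t} → TTree k t → EquivConstraint (gcon (label t)) → ∀ (n : Node t) → EquivConstraint (gcon (labelAt n))
    equiv-TUTree : ∀ {k t} → TUTree k t → EquivConstraint (gcon (label t)) → ∀ (n : Node t) → EquivConstraint (gcon (labelAt n))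
    preserves-TSel : ∀ {k s gs} → NodeCond (TSel (NegAnswerBelow k)) s gs → NodeCond (TSel PreservesEquiv) s gs
    preserves-TUSel : ∀ {k s gs} → NodeCond (TUSel (AnswerBelow k)) s gs → NodeCond (TUSel PreservesEquiv) s gs

    equiv-TTree {t = t} (ttree f) =
      equiv-nodes (TSel PreservesEquiv) equiv-child-T t (λ m → pathGoals m , preserves-TSel (f m))
    equiv-TUTree {t = t} (tutree f) =
      equiv-nodes (TUSel PreservesEquiv) equiv-child-TU t (λ m → pathGoals m , preserves-TUSel (f m))

    preserves-TSel (inj₁ leaf) = inj₁ leaf
    preserves-TSel (inj₂ (Ls , pos A , Ls' , eq , step)) = inj₂ (Ls , pos A , Ls' , eq , step)
    preserves-TSel (inj₂ (Ls , neg A , Ls' , eq , inj₁ leaf)) = inj₂ (Ls , neg A , Ls' , eq , inj₁ leaf)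
    preserves-TSel (inj₂ (Ls , neg A , Ls' , eq , inj₂ (sg , C' , (j , _ , t' , tu , t'≡ , na) , sat , eql))) =
      inj₂ (Ls , neg A , Ls' , eq , inj₂ (sg , C' ,
        lift (λ e → equiv-negAnswer t' (equiv-TUTree tu (subst (EquivConstraint ∘ gcon) (sym t'≡) e)) C' na) , sat , eql))

    preserves-TUSel (inj₁ leaf) = inj₁ leaf
    preserves-TUSel (inj₂ (Ls , pos A , Ls' , eq , step)) = inj₂ (Ls , pos A , Ls' , eq , step)
    preserves-TUSel (inj₂ (Ls , neg A , Ls' , eq , inj₁ drop)) = inj₂ (Ls , neg A , Ls' , eq , inj₁ drop)
    preserves-TUSel (inj₂ (Ls , neg A , Ls' , eq , inj₂ (inj₁ (sg , C'' , (j , _ , t' , tree , t'≡ , ans) , sat , eql)))) =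
      inj₂ (Ls , neg A , Ls' , eq , inj₂ (inj₁ (sg , C'' ,
        lift (λ e → equiv-answer t' (equiv-TTree tree (subst (EquivConstraint ∘ gcon) (sym t'≡) e)) C'' ans) , sat , eql)))
    preserves-TUSel (inj₂ (Ls , neg A , Ls' , eq , inj₂ (inj₂ (leaf , C'' , (j , _ , t' , tree , t'≡ , ans) , unsat)))) =
      inj₂ (Ls , neg A , Ls' , eq , inj₂ (inj₂ (leaf , C'' ,
        lift (λ e → equiv-answer t' (equiv-TTree tree (subst (EquivConstraint ∘ gcon) (sym t'≡) e)) C'' ans) , unsat)))

    -- Pin the variables xs to their θ-values, so that the witness property yields a ground valuation agreeing with θ.
    ground-witness : ∀ Cn (xs : List Var) → EquivConstraint Cn → ∀ ρ θ → ⟦_⟧ M0 Cn ρ → Agree M0 ρ (evg ∘ θ) xs →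
                     Σ (Var → GTerm) (λ θ' → Sat θ' Cn × GAgree θ' θ xs)
    ground-witness Cn xs (F' , isF' , equiv) ρ θ satCn agree = θ' , from (equiv (evg ∘ θ')) (proj₁ satD) , pinned
      where
        pin : Var → Form
        pin x = var x ≐ embed (θ x)
        D = F' ∧f conj (map pin xs)
        isD : IsC D
        isD = ∧C F' _ isF' (isC-conj _ (All.map⁺ {f = pin} (All.tabulate {xs = xs} (λ _ → eqC _ _))))
        satDρ : ⟦_⟧ M0 D ρ
        satDρ = to (equiv ρ) satCn , ⟦conj⟧⁺ M0 _ ρ (All.map⁺ {f = pin} (All.tabulate {xs = xs}
                  (λ {y} m → trans (agree y m) (sym (evT-embed ρ (θ y))))))
        witness = witnesses M0 mod D isD
                    (λ ρ₀ → exClose-intro M0 _ D ρ₀ ρ (λ y y∉ m → ⊥-elim (y∉ (∈-deduplicate⁺ _≟_ m))) satDρ)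
        θ' = proj₁ witness
        satD : Sat θ' D
        satD = ⊨[]→Sat θ' D (proj₂ witness)
        pinned : GAgree θ' θ xs
        pinned y m = evg-injective _ _ (trans (All.lookup (All.map⁻ {f = pin} (⟦conj⟧⁻ M0 _ (evg ∘ θ') (proj₂ satD))) m)
                                               (evT-embed (evg ∘ θ') (θ y)))

    groundable : Groundable
    groundable = record
      { Inv = λ F → Lift (lsuc 0ℓ) (EquivConstraint F)
      ; inv-constraint = λ F isC → lift (constraint-equiv F isC)
      ; inv-TTree = λ tree e n → lift (equiv-TTree tree (lower e) n)
      ; inv-TUTree = λ tree e n → lift (equiv-TUTree tree (lower e) n)
      ; groundable-leaves = λ {_} {t} tree e n _ → ground-witness (gcon (labelAt n)) (fvGoal (label t)) (equiv-TTree tree (lower e) n)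
      }

module SafeGrounding (em : ExcludedMiddle 0ℓ) (S : Sig) where
  open Hybrid S
  open FormulaSemantics S
  open FreeVariables S
  open GroundSyntax S
  open FreeTermAlgebra em S
  open Soundness em S

  module _ (T : Theory) (IsC : Form → Set) (SA : StandingAssumptions T IsC) (P : Rule → Set)
           (M0 : Structure) (mod : Model T M0) (safe : SafeProgram T P) where
    open Trees T IsC P
    open Structure M0
    open Ground M0
    open ModelOfCET T IsC SA M0 mod
    open Program T IsC SA P M0 mod

    lookup-evgV : ∀ {n} (gs : Vec GTerm n) i → lookup (evgV gs) i ≡ evg (lookup gs i)
    lookup-evgV (g ∷ gs) fz = refl
    lookup-evgV (g ∷ gs) (fs i) = lookup-evgV gs i

    IsGround : Carrier → Set
    IsGround d = Σ GTerm (λ g → evg g ≡ d)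

    data _⊑_ (d : Carrier) : Carrier → Set where
      ⊑-refl : d ⊑ d
      ⊑-arg : ∀ {e} f (ds : Vec Carrier (arity f)) i → d ⊑ lookup ds i → e ≡ fun f ds → d ⊑ e

    ⊑-trans : ∀ {d e e'} → d ⊑ e → e ⊑ e' → d ⊑ e'
    ⊑-trans p ⊑-refl = p
    ⊑-trans p (⊑-arg f ds i q eq) = ⊑-arg f ds i (⊑-trans p q) eq

    negAnswer-fvF : ∀ t' C' → NegAnswer t' C' → ∀ x → x ∈ fvF C' → x ∈ fvGoal (label t')
    negAnswer-fvF t' C' (_ , _ , inj₁ (cs , _ , refl)) x m
      with find (Any.map⁻ (fvF-conj (map (λ Ci → ¬f ∃₋ (label t') Ci) cs) x m))
    ... | Ci , _ , mi = fvF-∃₋ (label t') Ci x mi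
    negAnswer-fvF t' C' (_ , _ , inj₂ (_ , _ , fvs , _)) x m = fvs x m

    expansion-constraint : ∀ {gs Ls Ls' C A r G''} ρ → Expands gs Ls Ls' C A r G'' → ⟦_⟧ M0 (gcon G'') ρ → ⟦_⟧ M0 C ρ
    expansion-constraint {C = C} {r = rule (p , us) C₀ K} ρ (_ , (σ , inj , refl) , _ , der {ts = ts} , _) sat =
      proj₁ (proj₂ (⟦eqsF⟧⁻ M0 ts (renV σ us) (C ∧f renF σ C₀) ρ sat))

    -- The invariant behind safeness: every value of a goal variable is built by function symbols from ground
    -- values and subterms of values of variables of positive literals.  At a successful leaf no positive
    -- literal is left, so all values are ground.
    module Generation (ρ : Env M0) where
      data Generated (V : List Var) (d : Carrier) : Set where
        ground : IsGround d → Generated V d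
        below : ∀ y → y ∈ V → d ⊑ ρ y → Generated V d
        apply : ∀ f (ds : Vec Carrier (arity f)) → (∀ i → Generated V (lookup ds i)) → d ≡ fun f ds → Generated V d

      GoalGenerated : Form → List Lit → Set
      GoalGenerated C Ls = ∀ x → x ∈ fvF C ++ fvLits Ls → Generated (fvPosLits Ls) (ρ x)

      Generated-arg : ∀ {V e} → Generated V e → ∀ f ds → e ≡ fun f ds → ∀ i → Generated V (lookup ds i)
      Generated-arg (ground (gfn f' gs , eg)) f ds e i with fun-≡⁻ f' f (evgV gs) ds (trans eg e)
      ... | refl , eq = ground (lookup gs i , trans (sym (lookup-evgV gs i)) (cong (λ v → lookup v i) eq))
      Generated-arg (below y m p) f ds e i = below y m (⊑-trans (⊑-arg f ds i ⊑-refl e) p)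
      Generated-arg (apply f' ds' h e') f ds e i with fun-≡⁻ f' f ds' ds (trans (sym e') e)
      ... | refl , refl = h i

      Generated-⊑ : ∀ {V d e} → Generated V e → d ⊑ e → Generated V d
      Generated-⊑ c ⊑-refl = c
      Generated-⊑ c (⊑-arg f ds i p eq) = Generated-⊑ (Generated-arg c f ds eq i) p

      Generated-mono : ∀ {V V' d} → (∀ y → y ∈ V → y ∈ V') → Generated V d → Generated V' d
      Generated-mono h (ground g) = ground g
      Generated-mono h (below y m p) = below y (h y m) p
      Generated-mono h (apply f ds c e) = apply f ds (λ i → Generated-mono h (c i)) e

      Generated-evT : ∀ V u → (∀ x → x ∈ fvT u → Generated V (ρ x)) → Generated V (evT M0 ρ u)
      Generated-evV : ∀ V {n} (us : Vec Term n) → (∀ x → x ∈ fvV us → Generated V (ρ x)) →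
                      ∀ i → Generated V (lookup (evV M0 ρ us) i)
      Generated-evT V (var x) h = h x (here refl)
      Generated-evT V (fn f us) h = apply f (evV M0 ρ us) (Generated-evV V us h) refl
      Generated-evV V (u ∷ us) h fz = Generated-evT V u (λ x m → h x (∈-++⁺ˡ m))
      Generated-evV V (u ∷ us) h (fs i) = Generated-evV V us (λ x m → h x (∈-++⁺ʳ (fvT u) m)) i

      ⊑-evT : ∀ y t → y ∈ fvT t → ρ y ⊑ evT M0 ρ t
      ⊑-evV : ∀ y {n} (ts : Vec Term n) → y ∈ fvV ts → Σ (Fin n) (λ i → ρ y ⊑ lookup (evV M0 ρ ts) i)
      ⊑-evT y (var x) (here refl) = ⊑-refl
      ⊑-evT y (fn f ts) m = let (i , p) = ⊑-evV y ts m in ⊑-arg f (evV M0 ρ ts) i p refl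
      ⊑-evV y (t ∷ ts) m with ∈-++⁻ (fvT t) m
      ... | inj₁ p = fz , ⊑-evT y t p
      ... | inj₂ p = let (i , q) = ⊑-evV y ts p in fs i , q

      Generated[]⇒IsGround : ∀ {d} → Generated [] d → IsGround d
      Generated[]⇒IsGround (ground g) = g
      Generated[]⇒IsGround (apply f ds h refl) =
        gfn f gs , cong (fun f) (lookup-ext (evgV gs) ds (λ i → trans (lookup-evgV gs i)
                     (trans (cong evg (lookup∘tabulate (λ j → proj₁ (Generated[]⇒IsGround (h j))) i))
                            (proj₂ (Generated[]⇒IsGround (h i))))))
        where gs = tabulate (λ j → proj₁ (Generated[]⇒IsGround (h j)))

      module Resolution (Ls Ls' : List Lit) (C : Form) (p : RPred) (ts us : Vec Term (rarity p)) (C₀ : Form)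
                        (K : List Lit) (σ : ℕ → ℕ) (inj : Injective _≡_ _≡_ σ) (Pr : P (rule (p , us) C₀ K))
                        (sat : ⟦_⟧ M0 (eqsF ts (renV σ us) (C ∧f renF σ C₀)) ρ) where
        K' = map (renL σ) K
        Vnew = fvPosLits (Ls ++ K' ++ Ls')
        Vold = fvPosLits (Ls ++ pos (p , ts) ∷ Ls')

        args≡ : evV M0 ρ ts ≡ evV M0 ρ (renV σ us)
        args≡ = proj₁ (⟦eqsF⟧⁻ M0 ts (renV σ us) (C ∧f renF σ C₀) ρ sat)

        satC₀ : ⟦_⟧ M0 C₀ (ρ ∘ σ)
        satC₀ = proj₁ (⟦⟧-renF M0 σ inj C₀ ρ) (proj₂ (proj₂ (⟦eqsF⟧⁻ M0 ts (renV σ us) (C ∧f renF σ C₀) ρ sat)))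

        safe-var : ∀ z → (z ∈ fvV us ⊎ z ∈ fvNegLits K ⊎ z ∈ fvF C₀) → Generated Vnew (ρ (σ z))
        safe-var z h with safe (rule (p , us) C₀ K) Pr z h
        ... | inj₁ (g , bound) = ground (g , sym (trans (bound M0 mod (ρ ∘ σ) satC₀) (evT-embed (ρ ∘ σ) g)))
        ... | inj₂ (y , y∈ , bound) =
          below (σ y) (fvPosLits-++ʳ Ls (σ y) (fvPosLits-++ˡ K' (σ y) (fvPosLits-renL⁺ σ inj K y y∈)))
                (subst (_⊑ ρ (σ y)) (sym (bound M0 mod (ρ ∘ σ) satC₀)) ⊑-refl)

        head-generated : ∀ x → x ∈ fvV (renV σ us) → Generated Vnew (ρ x)
        head-generated x m with fvV-renV⁻ σ us x m
        ... | z , z∈ , refl = safe-var z (inj₁ z∈)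

        negative-generated : ∀ x → x ∈ fvNegLits K' → Generated Vnew (ρ x)
        negative-generated x m with fvNegLits-renL⁻ σ inj K x m
        ... | z , z∈ , refl = safe-var z (inj₂ (inj₁ z∈))

        constraint-generated : ∀ x → x ∈ fvF (renF σ C₀) → Generated Vnew (ρ x)
        constraint-generated x m with fvF-renF⁻ σ inj C₀ x m
        ... | z , z∈ , refl = safe-var z (inj₂ (inj₂ z∈))

        -- the variables of the resolved atom p(ts) are covered by the head of the rule
        old-generated : ∀ {d} → Generated Vold d → Generated Vnew d
        old-generated (ground g) = ground g
        old-generated (apply f ds h eq) = apply f ds (λ i → old-generated (h i)) eq
        old-generated (below y y∈ d⊑) with fvPosLits-++⁻ Ls y y∈
        ... | inj₁ m = below y (fvPosLits-++ˡ Ls y m) d⊑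
        ... | inj₂ m with ∈-++⁻ (fvV ts) m
        ...   | inj₂ m' = below y (fvPosLits-++ʳ Ls y (fvPosLits-++ʳ K' y m')) d⊑
        ...   | inj₁ m' with ⊑-evV y ts m'
        ...     | i , ρy⊑ = Generated-⊑ (Generated-evV Vnew (renV σ us) head-generated i)
                              (⊑-trans d⊑ (subst (ρ y ⊑_) (cong (λ v → lookup v i) args≡) ρy⊑))

        generated-resolvent : GoalGenerated C (Ls ++ pos (p , ts) ∷ Ls') →
                              GoalGenerated (eqsF ts (renV σ us) (C ∧f renF σ C₀)) (Ls ++ K' ++ Ls')
        generated-resolvent gen x m with ∈-++⁻ (fvF (eqsF ts (renV σ us) (C ∧f renF σ C₀))) m
        ... | inj₁ mf with fvF-eqsF ts (renV σ us) (C ∧f renF σ C₀) x mf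
        ...   | inj₁ mt = old-generated (gen x (∈-++⁺ʳ (fvF C) (fvLits-++ʳ Ls x (∈-++⁺ˡ mt))))
        ...   | inj₂ (inj₁ mu) = head-generated x mu
        ...   | inj₂ (inj₂ mc) = [ (λ mC → old-generated (gen x (∈-++⁺ˡ mC))) , constraint-generated x ]′ (∈-++⁻ (fvF C) mc)
        generated-resolvent gen x m | inj₂ ml with fvLits-++⁻ Ls x ml
        ...   | inj₁ mLs = old-generated (gen x (∈-++⁺ʳ (fvF C) (fvLits-++ˡ Ls x mLs)))
        ...   | inj₂ mr with fvLits-++⁻ K' x mr
        ...     | inj₂ mLs' = old-generated (gen x (∈-++⁺ʳ (fvF C) (fvLits-++ʳ Ls x (∈-++⁺ʳ (fvV ts) mLs'))))
        ...     | inj₁ mK with fvLits⊆fvPosLits∪fvNegLits K' x mK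
        ...       | inj₁ mp = below x (fvPosLits-++ʳ Ls x (fvPosLits-++ˡ K' x mp)) ⊑-refl
        ...       | inj₂ mn = negative-generated x mn

      generated-expansion : ∀ {gs} Ls Ls' C p ts r {G''} → P r → Expands gs Ls Ls' C (p , ts) r G'' →
                            ⟦_⟧ M0 (gcon G'') ρ → GoalGenerated C (Ls ++ pos (p , ts) ∷ Ls') → GoalGenerated (gcon G'') (lits G'')
      generated-expansion Ls Ls' C p ts (rule (.p , us) C₀ K) Pr (_ , (σ , inj , refl) , _ , der , _) sat =
        Resolution.generated-resolvent Ls Ls' C p ts us C₀ K σ inj Pr sat

      generated-child : ∀ {k} s gs → NodeCond (TSel (NegAnswerBelow k)) s gs → (c : Child s) →
                        ⟦_⟧ M0 (gcon (label (child s c))) ρ →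
                        GoalGenerated (gcon (label s)) (lits (label s)) →
                        GoalGenerated (gcon (label (child s c))) (lits (label (child s c)))
      generated-child s gs (inj₁ (_ , noChild)) c sat gen = ⊥-elim (noChild c)
      generated-child s gs (inj₂ (Ls , pos (p , ts) , Ls' , eq , (ro , Pro , _ , exps , _))) c sat gen =
        generated-expansion Ls Ls' (gcon (label s)) p ts (ro c) (Pro c) (exps c) sat (subst (GoalGenerated (gcon (label s))) eq gen)
      generated-child s gs (inj₂ (Ls , neg A , Ls' , eq , inj₁ noChild)) c sat gen = ⊥-elim (noChild c)
      generated-child s gs (inj₂ (Ls , neg A , Ls' , eq , inj₂ ((c₀ , unique) , C' , (_ , _ , t' , _ , t'≡ , na) , _ , eql))) c sat gen =
        subst (λ g → GoalGenerated (gcon g) (lits g)) (sym (trans (cong (λ c → label (child s c)) (unique c)) eql)) gen'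
        where
          C = gcon (label s)
          gen₀ : GoalGenerated C (Ls ++ neg A ∷ Ls')
          gen₀ = subst (GoalGenerated C) eq gen
          drop-neg : ∀ y → y ∈ fvPosLits (Ls ++ neg A ∷ Ls') → y ∈ fvPosLits (Ls ++ Ls')
          drop-neg y m = [ fvPosLits-++ˡ Ls y , fvPosLits-++ʳ Ls y ]′ (fvPosLits-++⁻ Ls y m)
          old : ∀ x → x ∈ fvF C ++ fvLits (Ls ++ neg A ∷ Ls') → Generated (fvPosLits (Ls ++ Ls')) (ρ x)
          old x m = Generated-mono drop-neg (gen₀ x m)
          fromGoal : ∀ x → x ∈ fvF C ++ fvA A ++ [] → Generated (fvPosLits (Ls ++ Ls')) (ρ x)
          fromGoal x m with ∈-++⁻ (fvF C) m
          ... | inj₁ mC = old x (∈-++⁺ˡ mC)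
          ... | inj₂ mA with ∈-++⁻ (fvA A) mA
          ...   | inj₁ mA' = old x (∈-++⁺ʳ (fvF C) (fvLits-++ʳ Ls x (∈-++⁺ˡ mA')))
          ...   | inj₂ ()
          gen' : GoalGenerated (C' ∧f C) (Ls ++ Ls')
          gen' x m with ∈-++⁻ (fvF (C' ∧f C)) m
          ... | inj₁ mf with ∈-++⁻ (fvF C') mf
          ...   | inj₁ mC' = fromGoal x (subst (λ g → x ∈ fvGoal g) t'≡ (negAnswer-fvF t' C' na x mC'))
          ...   | inj₂ mC = old x (∈-++⁺ˡ mC)
          gen' x m | inj₂ ml =
            [ (λ mLs → old x (∈-++⁺ʳ (fvF C) (fvLits-++ˡ Ls x mLs)))
            , (λ mLs' → old x (∈-++⁺ʳ (fvF C) (fvLits-++ʳ Ls x (∈-++⁺ʳ (fvA A) mLs')))) ]′ (fvLits-++⁻ Ls x ml)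

      child-constraint→parent : ∀ {k} s gs → NodeCond (TSel (NegAnswerBelow k)) s gs → (c : Child s) →
                                ⟦_⟧ M0 (gcon (label (child s c))) ρ → ⟦_⟧ M0 (gcon (label s)) ρ
      child-constraint→parent s gs (inj₁ (_ , noChild)) c sat = ⊥-elim (noChild c)
      child-constraint→parent s gs (inj₂ (Ls , pos A , Ls' , eq , (_ , _ , _ , exps , _))) c sat =
        expansion-constraint ρ (exps c) sat
      child-constraint→parent s gs (inj₂ (Ls , neg A , Ls' , eq , inj₁ noChild)) c sat = ⊥-elim (noChild c)
      child-constraint→parent s gs (inj₂ (Ls , neg A , Ls' , eq , inj₂ ((c₀ , unique) , _ , _ , _ , eql))) c sat =
        proj₂ (subst (λ g → ⟦_⟧ M0 (gcon g) ρ) (trans (cong (λ c → label (child s c)) (unique c)) eql) sat)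

      module _ (k : Ord) where
        TConditions : Tree → Set₁
        TConditions t = ∀ (m : Node t) → Σ (List Goal) (NodeCond (TSel (NegAnswerBelow k)) (subAt m))

        constraint-up : ∀ s → TConditions s → (n : Node s) → ⟦_⟧ M0 (gcon (labelAt n)) ρ → ⟦_⟧ M0 (gcon (label s)) ρ
        constraint-up s cond here sat = sat
        constraint-up s cond (there c n) sat = child-constraint→parent s _ (proj₂ (cond here)) c
                                                 (constraint-up (child s c) (λ m → cond (there c m)) n sat)

        generated-down : ∀ s → TConditions s → (n : Node s) → ⟦_⟧ M0 (gcon (labelAt n)) ρ →
                         GoalGenerated (gcon (label s)) (lits (label s)) → GoalGenerated (gcon (labelAt n)) (lits (labelAt n))
        generated-down s cond here sat gen = gen
        generated-down s cond (there c n) sat gen =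
          generated-down (child s c) (λ m → cond (there c m)) n sat
            (generated-child s _ (proj₂ (cond here)) c (constraint-up (child s c) (λ m → cond (there c m)) n sat) gen)

    safe-leaves : ∀ {k t} → TTree k t → GroundableLeaves t
    safe-leaves {k} {t} (ttree f) n succ ρ θ satn agree = θ' , satθ' , agreeθ'
      where
        open Generation ρ
        genRoot : GoalGenerated (gcon (label t)) (lits (label t))
        genRoot x m = ground (θ x , sym (agree x m))
        genLeaf = generated-down k t (λ m → pathGoals m , f m) n satn genRoot
        isGround : ∀ x → x ∈ fvGoal (labelAt n) → IsGround (ρ x)
        isGround x m = Generated[]⇒IsGround (subst (λ ls → Generated (fvPosLits ls) (ρ x)) succ (genLeaf x m))
        θ' : Var → GTerm
        θ' x with em {IsGround (ρ x)}
        ... | yes (g , _) = g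
        ... | no _ = θ x
        θ'-spec : ∀ x → IsGround (ρ x) → evg (θ' x) ≡ ρ x
        θ'-spec x isG with em {IsGround (ρ x)}
        ... | yes (g , e) = e
        ... | no ¬isG = ⊥-elim (¬isG isG)
        satθ' : Sat θ' (gcon (labelAt n))
        satθ' = ⟦⟧-agree M0 (gcon (labelAt n)) ρ (evg ∘ θ') (λ x m → sym (θ'-spec x (isGround x (∈-++⁺ˡ m)))) satn
        agreeθ' : GAgree θ' θ (fvGoal (label t))
        agreeθ' x m = evg-injective _ _ (trans (θ'-spec x (θ x , sym (agree x m))) (agree x m))

    groundable : Groundable
    groundable = record
      { Inv = λ _ → Lift (lsuc 0ℓ) ⊤
      ; inv-constraint = λ _ _ → lift tt
      ; inv-TTree = λ _ _ _ → lift tt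
      ; inv-TUTree = λ _ _ _ → lift tt
      ; groundable-leaves = λ tree _ → safe-leaves tree
      }

mainTheorem4 : ExcludedMiddle 0ℓ → ExcludedMiddle (lsuc 0ℓ) →
    (S : Sig) → let open Hybrid S in
    (T : Theory) (IsC : Form → Set) → StandingAssumptions T IsC →
    (P : Rule → Set) → (∀ r → P r → IsC (con r)) →
    (G : Goal) → IsC (gcon G) →
    (M0 : Structure) → Model T M0 →
    (k : Ord) →
    (Herbrand M0 ⊎ WitnessProperty T IsC ⊎ SafeProgram T P) →
    let open Trees T IsC P in
    ((t : Tree) (C : Form) → TTree k t → label t ≡ G → Answer t C →
    (θ : Var → GTerm) → M0 ⊨ (C [ θ ]F) → Holds3 M0 (Ψ↑ (P /M M0) (os k)) G θ)
    × ((t : Tree) (C : Form) → TUTree k t → label t ≡ G → NegAnswer t C →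
    (θ : Var → GTerm) → M0 ⊨ (C [ θ ]F) → HoldsNeg3 M0 (Ψ↑ (P /M M0) (os k)) G θ)
mainTheorem4 em _ S T IsC SA P rule-constraints G isC-G M0 mod k hypothesis =
  (λ t C tree t≡G ans θ h → subst (λ G → Holds3 M0 (Ψ↑ Q (os k)) G θ) t≡G
                              (tTree-sound k t tree (inv-root t t≡G) C ans θ h)) ,
  (λ t C tree t≡G na θ h → subst (λ G → HoldsNeg3 M0 (Ψ↑ Q (os k)) G θ) t≡G
                             (tuTree-sound k t tree (inv-root t t≡G) C na θ h))
  where
    open Hybrid S
    open Soundness em S
    open Trees T IsC P
    open Program T IsC SA P M0 mod

    groundable : Groundable
    groundable = [ HerbrandGrounding.groundable em S T IsC SA P M0 mod
                 , [ WitnessGrounding.groundable em S T IsC SA P rule-constraints M0 mod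
                   , SafeGrounding.groundable em S T IsC SA P M0 mod ]′ ]′ hypothesis

    open Groundable groundable
    open ByRank groundable

    inv-root : ∀ t → label t ≡ G → Inv (gcon (label t))
    inv-root t refl = inv-constraint (gcon G) isC-G
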